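{- Let $\alpha\ge 0$ and $k\ge 1$ be integers, let $p_1,\ldots,p_k$ be distinct odd primes and $\alpha_1,\ldots,\alpha_k$ positive integers, and let $n=2^{\alpha}\prod_{i=1}^{k}p_i^{\alpha_i}>8$. Let $R=\{r_i : p_i\equiv r_i \pmod 8,\ 0\le r_i\le 7,\ 1\le i\le k\}$ be the set of residues of the $p_i$ modulo $8$. Then $$\varphi_8(n)=\begin{cases} \frac18\varphi(n)+\frac14(-1)^{\Omega(n)}2^{\omega(n)-\alpha}, & \text{if } \alpha\in\{0,1\} \text{ and } R=\{5,7\} \text{ or } R=\{5\};\\[2pt] \frac18\varphi(n)+\frac18(-1)^{\Omega(n)-\lfloor(\alpha+1)/2\rfloor}2^{\omega(n)-\frac12(1-(-1)^{\alpha})}, & \text{if } \alpha\in\{0,1,2\} \text{ and } R=\{3,7\} \text{ or } R=\{3\};\\[2pt] \frac18\varphi(n)+\frac18(-1)^{\Omega(n)-\lfloor\alpha/2\rfloor}2^{\omega(n)-\frac12(1-(-1)^{\alpha})}+\frac{1-\lfloor(\alpha+1)/2\rfloor}{4}(-1)^{\Omega(n)}2^{\omega(n)}, & \text{if } \alpha\in\{0,1,2\} \text{ and } R=\{7\};\\[2pt] \frac18\varphi(n), & \text{otherwise}. \end{cases}$$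
   Context: For positive integers $n,e$, the generalized Euler function is $\varphi_e(n)=\#\{i\in\mathbb{Z}: 1\le i\le \lfloor n/e\rfloor,\ \gcd(i,n)=1\}$; $\varphi=\varphi_1$ is Euler's function. $\Omega(n)$ denotes the number of prime factors of $n$ counted with multiplicity and $\omega(n)$ the number of distinct prime factors of $n$. $\lfloor x\rfloor$ is the greatest integer not exceeding $x$. Conditions such as "$R=\{5,7\}$" mean equality of sets. -}

module Defs where

open import Data.Nat as ℕ using (ℕ; zero; suc; _≤_; _<_; NonZero)
open import Data.Nat.DivMod using (_/_; _%_)
open import Data.Nat.GCD using (gcd)
open import Data.Nat.Divisibility using (_∣_; _∣?_)
open import Data.Nat.Primality using (Prime; prime?)
open import Data.List using (List; length; filter; map; upTo; cartesianProduct)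
open import Data.List.Membership.Propositional using (_∈_)
open import Data.Fin using (Fin)
open import Data.Product using (_×_; _,_; ∃; proj₁; proj₂)
open import Relation.Nullary.Decidable using (_×-dec_)
open import Data.Integer using (+_)
open import Data.Rational as ℚ using (ℚ; 1ℚ)

[1‥_] : ℕ → List ℕ
[1‥ m ] = map suc (upTo m)

φ[_] : (e : ℕ) → .{{_ : NonZero e}} → ℕ → ℕ
φ[ e ] n = length (filter (λ i → gcd i n ℕ.≟ 1) [1‥ n / e ])

φ : ℕ → ℕ
φ n = φ[ 1 ] n

-- ω(n): number of distinct primes p dividing n (any such p satisfies p ≤ n for n ≥ 1)
ω : ℕ → ℕ
ω n = length (filter (λ p → prime? p ×-dec (p ∣? n)) [1‥ n ])

-- Ω(n) = Σ_p v_p(n) = #{(p, j) : p prime, j ≥ 1, p^j ∣ n}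
-- (for n ≥ 1 all such pairs have p ≤ n and j ≤ n)
Ω : ℕ → ℕ
Ω n = length (filter (λ pj → prime? (proj₁ pj) ×-dec ((proj₁ pj ℕ.^ proj₂ pj) ∣? n))
                     (cartesianProduct [1‥ n ] [1‥ n ]))

∏ : (k : ℕ) → (Fin k → ℕ) → ℕ
∏ zero f = 1
∏ (suc k) f = f Fin.zero ℕ.* ∏ k (λ i → f (Fin.suc i))
  where import Data.Fin as Fin

_^ℚ_ : ℚ → ℕ → ℚ
q ^ℚ zero = 1ℚ
q ^ℚ suc m = q ℚ.* (q ^ℚ m)

ℕ→ℚ : ℕ → ℚ
ℕ→ℚ m = + m ℚ./ 1

-1ℚ : ℚ
-1ℚ = ℚ.- 1ℚ

ResidueSetIs : (k : ℕ) → (Fin k → ℕ) → List ℕ → Set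
ResidueSetIs k p S = (∀ i → p i % 8 ∈ S) × (∀ r → r ∈ S → ∃ λ i → p i % 8 ≡ r)
  where open import Relation.Binary.PropositionalEquality using (_≡_)

-- Let S(x) count the 1 ≤ i ≤ x divisible by none of the primes of n, so that φ(n) = S(n) and
-- φ₈(n) = S(⌊n/8⌋).  Sieving out one more prime r replaces S(x) by S(x) − S(⌊x/r⌋), so
-- Δ(x) = S(x) − 8 S(⌊x/8⌋) obeys the same recursion, starting from Δ(x) = x mod 8 when nothing is
-- sieved.  For x = 2^β m with m odd, x mod 8 is a combination of 1, χ₄(m) and χ₈(m), where χ₄ = (−4/·)
-- and χ₈ = (−8/·) are completely multiplicative with χ(r)² = 1 for odd r; hence sieving out an odd
-- prime r ∣ m kills the constant part and multiplies each χ-part by 1 − χ(r).  For n = 2^α M this gives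
--   φ(n) − 8 φ₈(n) = d₄(α) χ₄(M) ∏ (1 − χ₄(p)) + d₈(α) χ₈(M) ∏ (1 − χ₈(p)),
-- and each product is 2^k if χ(p) = −1 for every p ∣ M and 0 otherwise.  Which products survive is
-- read off the residue set R, and then χ(M) = (−1)^(Ω(n) − α) and ω(n) give the stated formulas.

module Submission where

open import Defs
open import Data.Nat using (ℕ; _≤_; _<_; _^_; _*_; _+_; _∸_)
open import Data.Nat.DivMod using (_/_; _%_)
open import Data.Nat.Primality using (Prime)
open import Data.Fin using (Fin)
open import Data.List using (_∷_; [])
open import Data.Product using (_×_)
open import Data.Sum using (_⊎_)
open import Data.Integer using (+_)
open import Data.Rational as ℚ using (ℚ; 1ℚ)
open import Function.Definitions using (Injective)
open import Relation.Binary.PropositionalEquality using (_≡_)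
open import Relation.Nullary using (¬_)

open import Algebra.Properties.CommutativeSemigroup using (interchange)
open import Data.Bool using (Bool; true; false; not; _∧_)
open import Data.Bool.Properties using (∧-comm)
open import Data.Empty using (⊥-elim)
import Data.Fin as Fin
import Data.Fin.Properties as Finₚ
open import Data.Integer as ℤ using (ℤ; -[1+_]; -1ℤ)
import Data.Integer.Properties as ℤₚ
open import Data.Integer.Solver using (module +-*-Solver)
open import Data.List using (length; filter; map; upTo; cartesianProduct; _++_; [_])
open import Data.List.Properties
  using (upTo-∷ʳ; map-++; filter-++; length-++; ++-identityʳ; cartesianProductWith-distribʳ-++)
open import Data.List.Relation.Unary.All using (All)
import Data.List.Relation.Unary.All as All
open import Data.List.Relation.Unary.Any using (here; there)
open import Data.Nat as ℕ using (zero; suc; z≤n; s≤s; z<s; s<s; NonZero; _⊓_; _≤?_; _≟_)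
open import Data.Nat.Base using (nonTrivial⇒n>1)
open import Data.Nat.Coprimality using (Coprime; coprime-divisor; coprime⇒gcd≡1; gcd≡1⇒coprime)
open import Data.Nat.Divisibility
  using (_∣_; _∤_; _∣?_; divides; ∣⇒≤; ∣m+n∣m⇒∣n; m∣m*n; ∣1⇒≡1; ∣-trans; ∣-refl; ∣n⇒∣m*n; *-monoʳ-∣; *-cancelˡ-∣;
         m%n≡0⇒n∣m; n∣m⇒m%n≡0; m/n∣m)
open import Data.Nat.DivMod
  using (m≡m%n+[m/n]*n; m%n<n; m/n/o≡m/[n*o]; /-congʳ; %-distribˡ-*; m∣n⇒o%n%m≡o%m; m*[n/m]≡n; m*n%n≡0; *-/-assoc;
         n/1≡n; m*n/n≡m)
open import Data.Nat.GCD using (gcd)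
open import Data.Nat.Primality
  using (prime?; prime⇒nonTrivial; prime[2]; prime⇒irreducible; prime⇒nonZero; euclidsLemma; ¬prime[1])
open import Data.Nat.Properties
import Data.Nat.Solver as ℕ-Solver
open import Data.Product using (_,_; proj₂; ∃; uncurry)
open import Data.Rational using (toℚᵘ)
import Data.Rational.Properties as ℚₚ
open import Data.Rational.Properties using (toℚᵘ-injective; toℚᵘ-fromℚᵘ; toℚᵘ-homo-+; toℚᵘ-homo-*; toℚᵘ-homo‿-)
import Data.Rational.Solver as ℚ-Solver
import Data.Rational.Unnormalised as ℚᵘ
import Data.Rational.Unnormalised.Properties as ℚᵘₚ
open import Data.Sum using (inj₁; inj₂) renaming ([_,_]′ to either)
open import Data.Vec.Functional using (head; tail; foldr)
import Data.Vec.Functional as Vec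
open import Function using (_∘_; id)
open import Function.Bundles using (mk⇔)
open import Relation.Binary.PropositionalEquality
  using (refl; sym; trans; cong; cong₂; subst; _≢_; module ≡-Reasoning)
open import Relation.Nullary using (Dec; yes; no; does)
open import Relation.Nullary.Decidable
  using (dec-true; dec-false; does-⇔; map′; ¬?; _×-dec_; toWitness; _⊎-dec_; _→-dec_)
open import Relation.Unary using (Decidable)

-- Counting on [1, x]

iverson : Bool → ℕ
iverson true = 1
iverson false = 0

sumUpTo : (ℕ → ℕ) → ℕ → ℕ
sumUpTo g zero = 0
sumUpTo g (suc x) = sumUpTo g x + g (suc x)

count : (ℕ → Bool) → ℕ → ℕ
count f = sumUpTo (λ i → iverson (f i))

sumUpTo-cong : ∀ {g h} x → (∀ i → 1 ≤ i → i ≤ x → g i ≡ h i) → sumUpTo g x ≡ sumUpTo h x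
sumUpTo-cong zero eq = refl
sumUpTo-cong (suc x) eq =
  cong₂ _+_ (sumUpTo-cong x (λ i 1≤i i≤x → eq i 1≤i (m≤n⇒m≤1+n i≤x))) (eq (suc x) (s≤s z≤n) ≤-refl)

sumUpTo-+ : ∀ g h x → sumUpTo (λ i → g i + h i) x ≡ sumUpTo g x + sumUpTo h x
sumUpTo-+ g h zero = refl
sumUpTo-+ g h (suc x) = trans (cong (_+ (g (suc x) + h (suc x))) (sumUpTo-+ g h x))
                              (interchange +-commutativeSemigroup (sumUpTo g x) (sumUpTo h x) _ _)

sumUpTo-zero : ∀ g x → (∀ i → 1 ≤ i → i ≤ x → g i ≡ 0) → sumUpTo g x ≡ 0
sumUpTo-zero g zero eq = refl
sumUpTo-zero g (suc x) eq =
  cong₂ _+_ (sumUpTo-zero g x (λ i 1≤i i≤x → eq i 1≤i (m≤n⇒m≤1+n i≤x))) (eq (suc x) (s≤s z≤n) ≤-refl)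

sumUpTo-single : ∀ g c x → 1 ≤ c → c ≤ x → (∀ i → i ≢ c → g i ≡ 0) → sumUpTo g x ≡ g c
sumUpTo-single g (suc c) zero _ () _
sumUpTo-single g c (suc x) 1≤c c≤1+x others with c ≟ suc x
... | yes refl = cong (_+ g c) (sumUpTo-zero g x (λ i _ i≤x → others i (<⇒≢ (s≤s i≤x))))
... | no c≢1+x = begin
  sumUpTo g x + g (suc x) ≡⟨ cong₂ _+_ (sumUpTo-single g c x 1≤c (≤-pred (≤∧≢⇒< c≤1+x c≢1+x)) others)
                                       (others (suc x) (c≢1+x ∘ sym)) ⟩
  g c + 0                 ≡⟨ +-identityʳ (g c) ⟩
  g c                     ∎
  where open ≡-Reasoning

count-cong : ∀ {f g} x → (∀ i → 1 ≤ i → i ≤ x → f i ≡ g i) → count f x ≡ count g x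
count-cong x eq = sumUpTo-cong x (λ i 1≤i i≤x → cong iverson (eq i 1≤i i≤x))

count-split : ∀ (f g : ℕ → Bool) x → count f x ≡ count (λ i → f i ∧ g i) x + count (λ i → f i ∧ not (g i)) x
count-split f g x = trans (sumUpTo-cong {h = λ i → iverson (f i ∧ g i) + iverson (f i ∧ not (g i))} x
                                        (λ i _ _ → iverson-split (f i) (g i)))
                          (sumUpTo-+ (λ i → iverson (f i ∧ g i)) (λ i → iverson (f i ∧ not (g i))) x)
  where
  iverson-split : ∀ a b → iverson a ≡ iverson (a ∧ b) + iverson (a ∧ not b)
  iverson-split true true = refl
  iverson-split true false = refl
  iverson-split false b = refl

count-true : ∀ x → count (λ _ → true) x ≡ x
count-true zero = refl
count-true (suc x) = trans (cong (_+ 1) (count-true x)) (+-comm x 1)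

count-≤ : ∀ b x → count (λ i → does (i ≤? b)) x ≡ x ⊓ b
count-≤ b zero = refl
count-≤ b (suc x) = begin
  count (λ i → does (i ≤? b)) x + iverson (does (suc x ≤? b)) ≡⟨ cong (_+ iverson (does (suc x ≤? b))) (count-≤ b x) ⟩
  x ⊓ b + iverson (does (suc x ≤? b))                         ≡⟨ last-step (suc x ≤? b) ⟩
  suc x ⊓ b                                                   ∎
  where
  open ≡-Reasoning
  last-step : (d : Dec (suc x ≤ b)) → x ⊓ b + iverson (does d) ≡ suc x ⊓ b
  last-step (yes 1+x≤b) = begin
    x ⊓ b + 1 ≡⟨ cong (_+ 1) (m≤n⇒m⊓n≡m (<⇒≤ 1+x≤b)) ⟩
    x + 1     ≡⟨ +-comm x 1 ⟩
    suc x     ≡⟨ m≤n⇒m⊓n≡m 1+x≤b ⟨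
    suc x ⊓ b ∎
  last-step (no 1+x≰b) = begin
    x ⊓ b + 0 ≡⟨ +-identityʳ _ ⟩
    x ⊓ b     ≡⟨ m≥n⇒m⊓n≡n b≤x ⟩
    b         ≡⟨ m≥n⇒m⊓n≡n (m≤n⇒m≤1+n b≤x) ⟨
    suc x ⊓ b ∎
    where b≤x = ≤-pred (≰⇒> 1+x≰b)

module _ (f : ℕ → Bool) (q : ℕ) .{{_ : NonZero q}} where

  private
    Multiple : ℕ → Bool
    Multiple i = does (q ∣? i) ∧ f i

  count-multiples-within-block : ∀ t r → r < q → count Multiple (t * q + r) ≡ count Multiple (t * q)
  count-multiples-within-block t zero _ = cong (count Multiple) (+-identityʳ (t * q))
  count-multiples-within-block t (suc r) 1+r<q = begin
    count Multiple (t * q + suc r)               ≡⟨ cong (count Multiple) (+-suc (t * q) r) ⟩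
    count Multiple (t * q + r) + iverson (Multiple (suc (t * q + r)))
      ≡⟨ cong₂ _+_ (count-multiples-within-block t r (<-trans (n<1+n r) 1+r<q))
                   (cong (λ b → iverson (b ∧ f (suc (t * q + r)))) (dec-false (q ∣? _) q∤)) ⟩
    count Multiple (t * q) + 0                   ≡⟨ +-identityʳ _ ⟩
    count Multiple (t * q)                       ∎
    where
    open ≡-Reasoning
    q∤ : q ∤ suc (t * q + r)
    q∤ q∣ = <⇒≱ 1+r<q (∣⇒≤ (∣m+n∣m⇒∣n (subst (q ∣_) (sym (+-suc (t * q) r)) q∣) (divides t refl)))

  count-multiples-blocks : ∀ t → count Multiple (t * q) ≡ count (λ j → f (q * j)) t
  count-multiples-blocks zero = refl
  count-multiples-blocks (suc t) = begin
    count Multiple (suc t * q)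
      ≡⟨ cong (count Multiple) last-in-block ⟩
    count Multiple (t * q + ℕ.pred q) + iverson (Multiple (suc (t * q + ℕ.pred q)))
      ≡⟨ cong₂ _+_ (count-multiples-within-block t (ℕ.pred q) (≤-reflexive (suc-pred q)))
                   (cong (iverson ∘ Multiple) (trans (sym last-in-block) (*-comm (suc t) q))) ⟩
    count Multiple (t * q) + iverson (Multiple (q * suc t))
      ≡⟨ cong₂ _+_ (count-multiples-blocks t)
                   (cong (λ b → iverson (b ∧ f (q * suc t))) (dec-true (q ∣? _) (m∣m*n (suc t)))) ⟩
    count (λ j → f (q * j)) (suc t) ∎
    where
    open ≡-Reasoning
    last-in-block : suc t * q ≡ suc (t * q + ℕ.pred q)
    last-in-block = begin
      q + t * q                ≡⟨ +-comm q (t * q) ⟩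
      t * q + q                ≡⟨ cong (_+_ (t * q)) (suc-pred q) ⟨
      t * q + suc (ℕ.pred q)   ≡⟨ +-suc (t * q) (ℕ.pred q) ⟩
      suc (t * q + ℕ.pred q)   ∎

  count-multiples : ∀ x → count Multiple x ≡ count (λ j → f (q * j)) (x / q)
  count-multiples x = begin
    count Multiple x                   ≡⟨ cong (count Multiple) (trans (m≡m%n+[m/n]*n x q) (+-comm (x % q) _)) ⟩
    count Multiple (x / q * q + x % q) ≡⟨ count-multiples-within-block (x / q) (x % q) (m%n<n x q) ⟩
    count Multiple (x / q * q)         ≡⟨ count-multiples-blocks (x / q) ⟩
    count (λ j → f (q * j)) (x / q)    ∎
    where open ≡-Reasoning

module _ {p} {P : ℕ → Set p} (P? : Decidable P) where

  length-filter-[1‥] : ∀ x → length (filter P? [1‥ x ]) ≡ count (λ i → does (P? i)) x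
  length-filter-[1‥] zero = refl
  length-filter-[1‥] (suc x) = begin
    length (filter P? (map suc (upTo (suc x))))
      ≡⟨ cong (λ l → length (filter P? (map suc l))) (sym (upTo-∷ʳ x)) ⟩
    length (filter P? (map suc (upTo x ++ [ x ])))
      ≡⟨ cong (λ l → length (filter P? l)) (map-++ suc (upTo x) [ x ]) ⟩
    length (filter P? ([1‥ x ] ++ [ suc x ]))
      ≡⟨ cong length (filter-++ P? [1‥ x ] [ suc x ]) ⟩
    length (filter P? [1‥ x ] ++ filter P? [ suc x ])
      ≡⟨ length-++ (filter P? [1‥ x ]) ⟩
    length (filter P? [1‥ x ]) + length (filter P? [ suc x ])
      ≡⟨ cong₂ _+_ (length-filter-[1‥] x) (length-filter-[ suc x ]) ⟩
    count (λ i → does (P? i)) (suc x) ∎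
    where
    open ≡-Reasoning
    length-filter-[_] : ∀ y → length (filter P? [ y ]) ≡ iverson (does (P? y))
    length-filter-[ y ] with does (P? y)
    ... | true = refl
    ... | false = refl

module _ {p} {P : ℕ × ℕ → Set p} (P? : Decidable P) where

  length-filter-[1‥]² : ∀ m n → length (filter P? (cartesianProduct [1‥ m ] [1‥ n ]))
                                ≡ sumUpTo (λ x → count (λ y → does (P? (x , y))) n) m
  length-filter-[1‥]² zero n = refl
  length-filter-[1‥]² (suc m) n = begin
    length (filter P? (cartesianProduct (map suc (upTo (suc m))) [1‥ n ]))
      ≡⟨ cong (λ l → length (filter P? (cartesianProduct (map suc l) [1‥ n ]))) (sym (upTo-∷ʳ m)) ⟩
    length (filter P? (cartesianProduct (map suc (upTo m ++ [ m ])) [1‥ n ]))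
      ≡⟨ cong (λ l → length (filter P? (cartesianProduct l [1‥ n ]))) (map-++ suc (upTo m) [ m ]) ⟩
    length (filter P? (cartesianProduct ([1‥ m ] ++ [ suc m ]) [1‥ n ]))
      ≡⟨ cong (λ l → length (filter P? l)) (cartesianProductWith-distribʳ-++ _,_ [1‥ m ] [ suc m ] [1‥ n ]) ⟩
    length (filter P? (cartesianProduct [1‥ m ] [1‥ n ] ++ (map (suc m ,_) [1‥ n ] ++ [])))
      ≡⟨ cong length (filter-++ P? (cartesianProduct [1‥ m ] [1‥ n ]) _) ⟩
    length (filter P? (cartesianProduct [1‥ m ] [1‥ n ]) ++ filter P? (map (suc m ,_) [1‥ n ] ++ []))
      ≡⟨ length-++ (filter P? (cartesianProduct [1‥ m ] [1‥ n ])) ⟩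
    length (filter P? (cartesianProduct [1‥ m ] [1‥ n ])) + length (filter P? (map (suc m ,_) [1‥ n ] ++ []))
      ≡⟨ cong₂ _+_ (length-filter-[1‥]² m n)
                   (trans (cong (λ l → length (filter P? l)) (++-identityʳ (map (suc m ,_) [1‥ n ])))
                          (trans (length-filter-map (suc m) [1‥ n ]) (length-filter-[1‥] (λ y → P? (suc m , y)) n))) ⟩
    sumUpTo (λ x → count (λ y → does (P? (x , y))) n) (suc m) ∎
    where
    open ≡-Reasoning
    length-filter-map : ∀ x ys → length (filter P? (map (x ,_) ys)) ≡ length (filter (λ y → P? (x , y)) ys)
    length-filter-map x [] = refl
    length-filter-map x (y ∷ ys) with does (P? (x , y))
    ... | true = cong suc (length-filter-map x ys)
    ... | false = length-filter-map x ys

∑ : ∀ {K} → (Fin K → ℕ) → ℕ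
∑ = foldr _+_ 0

∑-cong : ∀ {K} {f g : Fin K → ℕ} → (∀ j → f j ≡ g j) → ∑ f ≡ ∑ g
∑-cong {zero} eq = refl
∑-cong {suc K} eq = cong₂ _+_ (eq Fin.zero) (∑-cong (eq ∘ Fin.suc))

∑-const-1 : ∀ K → ∑ {K} (λ _ → 1) ≡ K
∑-const-1 zero = refl
∑-const-1 (suc K) = cong suc (∑-const-1 K)

sumUpTo-∑ : ∀ {K} (g : Fin K → ℕ → ℕ) x → sumUpTo (λ i → ∑ (λ j → g j i)) x ≡ ∑ (λ j → sumUpTo (g j) x)
sumUpTo-∑ {zero} g x = sumUpTo-zero (λ _ → 0) x (λ _ _ _ → refl)
sumUpTo-∑ {suc K} g x = trans (sumUpTo-+ (head g) (λ i → ∑ (λ j → tail g j i)) x)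
                              (cong (_+_ (sumUpTo (head g) x)) (sumUpTo-∑ (tail g) x))

δ : ℕ → ℕ → ℕ
δ m n = iverson (does (m ≟ n))

∑-select-none : ∀ {K} (q h : Fin K → ℕ) p → (∀ j → p ≢ q j) → ∑ (λ j → δ p (q j) * h j) ≡ 0
∑-select-none {zero} q h p p∉q = refl
∑-select-none {suc K} q h p p∉q rewrite dec-false (p ≟ head q) (p∉q Fin.zero) =
  ∑-select-none (tail q) (tail h) p (p∉q ∘ Fin.suc)

∑-select : ∀ {K} (q h : Fin K → ℕ) → Injective _≡_ _≡_ q → ∀ {p} j → p ≡ q j → ∑ (λ j → δ p (q j) * h j) ≡ h j
∑-select q h q-inj Fin.zero refl rewrite dec-true (head q ≟ head q) refl = begin
  h Fin.zero + 0 + ∑ (λ j → δ (head q) (tail q j) * tail h j)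
    ≡⟨ cong₂ _+_ (+-identityʳ _) (∑-select-none (tail q) (tail h) (head q) (λ j → Finₚ.0≢1+n ∘ q-inj)) ⟩
  h Fin.zero + 0 ≡⟨ +-identityʳ _ ⟩
  h Fin.zero ∎
  where open ≡-Reasoning
∑-select q h q-inj (Fin.suc j) refl rewrite dec-false (q (Fin.suc j) ≟ head q) (Finₚ.0≢1+n ∘ sym ∘ q-inj) =
  ∑-select (tail q) (tail h) (Finₚ.suc-injective ∘ q-inj) j refl

sumUpTo-δ : ∀ c h x → 1 ≤ c → c ≤ x → sumUpTo (λ p → δ p c * h) x ≡ h
sumUpTo-δ c h x 1≤c c≤x = begin
  sumUpTo (λ p → δ p c * h) x ≡⟨ sumUpTo-single (λ p → δ p c * h) c x 1≤c c≤x
                                   (λ p p≢c → cong (λ b → iverson b * h) (dec-false (p ≟ c) p≢c)) ⟩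
  δ c c * h                   ≡⟨ cong (λ b → iverson b * h) (dec-true (c ≟ c) refl) ⟩
  1 * h                       ≡⟨ *-identityˡ h ⟩
  h                           ∎
  where open ≡-Reasoning

prime∣prime⇒≡ : ∀ {p q} → Prime p → Prime q → p ∣ q → p ≡ q
prime∣prime⇒≡ p-prime q-prime p∣q with prime⇒irreducible q-prime p∣q
... | inj₁ refl = ⊥-elim (¬prime[1] p-prime)
... | inj₂ p≡q = p≡q

prime∣^⇒∣ : ∀ {p} q b → Prime p → p ∣ q ^ b → p ∣ q
prime∣^⇒∣ q zero p-prime p∣1 = ⊥-elim (¬prime[1] (subst Prime (∣1⇒≡1 p∣1) p-prime))
prime∣^⇒∣ q (suc b) p-prime p∣q^1+b with euclidsLemma q (q ^ b) p-prime p∣q^1+b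
... | inj₁ p∣q = p∣q
... | inj₂ p∣q^b = prime∣^⇒∣ q b p-prime p∣q^b

∏-factor-∣ : ∀ K (f : Fin K → ℕ) j → f j ∣ ∏ K f
∏-factor-∣ (suc K) f Fin.zero = m∣m*n _
∏-factor-∣ (suc K) f (Fin.suc j) = ∣n⇒∣m*n (head f) (∏-factor-∣ K (tail f) j)

prime∣∏⇒≡ : ∀ K (q b : Fin K → ℕ) {p} → (∀ j → Prime (q j)) → Prime p
          → p ∣ ∏ K (λ j → q j ^ b j) → ∃ λ j → p ≡ q j
prime∣∏⇒≡ zero q b q-prime p-prime p∣1 = ⊥-elim (¬prime[1] (subst Prime (∣1⇒≡1 p∣1) p-prime))
prime∣∏⇒≡ (suc K) q b q-prime p-prime p∣∏ with euclidsLemma (head q ^ head b) _ p-prime p∣∏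
... | inj₁ p∣q₀^b₀ = Fin.zero , prime∣prime⇒≡ p-prime (q-prime Fin.zero) (prime∣^⇒∣ (head q) (head b) p-prime p∣q₀^b₀)
... | inj₂ p∣rest with prime∣∏⇒≡ K (tail q) (tail b) (q-prime ∘ Fin.suc) p-prime p∣rest
...   | j , p≡q = Fin.suc j , p≡q

coprime-* : ∀ {i a b} → Coprime i a → Coprime i b → Coprime i (a * b)
coprime-* {a = a} i⊥a i⊥b {d} (d∣i , d∣ab) = i⊥b (d∣i , coprime-divisor d⊥a d∣ab)
  where
  d⊥a : Coprime d a
  d⊥a (e∣d , e∣a) = i⊥a (∣-trans e∣d d∣i , e∣a)

coprime-^ : ∀ {i q} b → Coprime i q → Coprime i (q ^ b)
coprime-^ zero i⊥q (_ , d∣1) = ∣1⇒≡1 d∣1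
coprime-^ (suc b) i⊥q = coprime-* i⊥q (coprime-^ b i⊥q)

prime∤⇒coprime : ∀ {i q} → Prime q → q ∤ i → Coprime i q
prime∤⇒coprime q-prime q∤i (d∣i , d∣q) with prime⇒irreducible q-prime d∣q
... | inj₁ d≡1 = d≡1
... | inj₂ refl = ⊥-elim (q∤i d∣i)

coprime-∏ : ∀ {i} K (q b : Fin K → ℕ) → (∀ j → Prime (q j)) → (∀ j → q j ∤ i)
          → Coprime i (∏ K (λ j → q j ^ b j))
coprime-∏ zero q b q-prime q∤i (_ , d∣1) = ∣1⇒≡1 d∣1
coprime-∏ (suc K) q b q-prime q∤i =
  coprime-* (coprime-^ (head b) (prime∤⇒coprime (q-prime Fin.zero) (q∤i Fin.zero)))
            (coprime-∏ K (tail q) (tail b) (q-prime ∘ Fin.suc) (q∤i ∘ Fin.suc))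

^-∣-^ : ∀ x {e b} → e ≤ b → x ^ e ∣ x ^ b
^-∣-^ x {zero} {b} _ = divides (x ^ b) (sym (*-identityʳ (x ^ b)))
^-∣-^ x (s≤s e≤b) = *-monoʳ-∣ x (^-∣-^ x e≤b)

prime^∣^*⇒≤ : ∀ {q r} → Prime q → q ∤ r → ∀ e b → q ^ e ∣ q ^ b * r → e ≤ b
prime^∣^*⇒≤ q-prime q∤r zero b _ = z≤n
prime^∣^*⇒≤ {q} {r} q-prime q∤r (suc e) zero q^1+e∣r =
  ⊥-elim (q∤r (∣-trans (m∣m*n (q ^ e)) (subst (q * q ^ e ∣_) (+-identityʳ r) q^1+e∣r)))
prime^∣^*⇒≤ {q} {r} q-prime q∤r (suc e) (suc b) q^1+e∣ =
  s≤s (prime^∣^*⇒≤ q-prime q∤r e b (*-cancelˡ-∣ q (subst (q * q ^ e ∣_) (*-assoc q (q ^ b) r) q^1+e∣)))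
  where instance _ = prime⇒nonZero q-prime

prime^∣∏⇒≤ : ∀ K (q b : Fin K → ℕ) → (∀ j → Prime (q j)) → Injective _≡_ _≡_ q
           → ∀ j e → q j ^ e ∣ ∏ K (λ i → q i ^ b i) → e ≤ b j
prime^∣∏⇒≤ (suc K) q b q-prime q-inj Fin.zero e q₀^e∣ = prime^∣^*⇒≤ (q-prime Fin.zero) q₀∤rest e (head b) q₀^e∣
  where
  q₀∤rest : q Fin.zero ∤ ∏ K (λ i → q (Fin.suc i) ^ b (Fin.suc i))
  q₀∤rest q₀∣rest with prime∣∏⇒≡ K (tail q) (tail b) (q-prime ∘ Fin.suc) (q-prime Fin.zero) q₀∣rest
  ... | j , q₀≡qⱼ with q-inj q₀≡qⱼ
  ... | ()
prime^∣∏⇒≤ (suc K) q b q-prime q-inj (Fin.suc j) e qⱼ^e∣ =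
  prime^∣∏⇒≤ K (tail q) (tail b) (q-prime ∘ Fin.suc) (Finₚ.suc-injective ∘ q-inj) j e (coprime-divisor qⱼ^e⊥q₀^b₀ qⱼ^e∣)
  where
  q₀∤qⱼ^e : q Fin.zero ∤ q (Fin.suc j) ^ e
  q₀∤qⱼ^e q₀∣ with q-inj (prime∣prime⇒≡ (q-prime Fin.zero) (q-prime (Fin.suc j)) (prime∣^⇒∣ _ e (q-prime Fin.zero) q₀∣))
  ... | ()
  qⱼ^e⊥q₀^b₀ : Coprime (q (Fin.suc j) ^ e) (q Fin.zero ^ b Fin.zero)
  qⱼ^e⊥q₀^b₀ = coprime-^ (head b) (prime∤⇒coprime (q-prime Fin.zero) q₀∤qⱼ^e)

n<m^n : ∀ {m} → 2 ≤ m → ∀ n → n < m ^ n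
n<m^n 2≤m zero = s≤s z≤n
n<m^n {m} 2≤m (suc n) = begin-strict
  suc n         <⟨ m<m+n (suc n) z<s ⟩
  suc n + suc n ≡⟨ cong (_+_ (suc n)) (+-identityʳ (suc n)) ⟨
  2 * suc n     ≤⟨ *-mono-≤ 2≤m (n<m^n 2≤m n) ⟩
  m * m ^ n     ∎
  where open ≤-Reasoning

∏-pos : ∀ K (f : Fin K → ℕ) → (∀ j → 1 ≤ f j) → 1 ≤ ∏ K f
∏-pos zero f f-pos = ≤-refl
∏-pos (suc K) f f-pos = *-mono-≤ (f-pos Fin.zero) (∏-pos K (tail f) (f-pos ∘ Fin.suc))

Odd : ℕ → Set
Odd m = m % 2 ≡ 1

odd? : ∀ m → Dec (Odd m)
odd? m = m % 2 ≟ 1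

odd⇒2∤ : ∀ {m} → Odd m → 2 ∤ m
odd⇒2∤ {m} m-odd 2∣m with trans (sym (n∣m⇒m%n≡0 m 2 2∣m)) m-odd
... | ()

2∤⇒odd : ∀ {m} → 2 ∤ m → Odd m
2∤⇒odd {m} 2∤m with m % 2 | m%n<n m 2 | m%n≡0⇒n∣m m 2
... | 0 | _ | 2∣m = ⊥-elim (2∤m (2∣m refl))
... | 1 | _ | _ = refl
... | suc (suc _) | s≤s (s≤s ()) | _

odd-∣ : ∀ {d m} → Odd m → d ∣ m → Odd d
odd-∣ m-odd d∣m = 2∤⇒odd (λ 2∣d → odd⇒2∤ m-odd (∣-trans 2∣d d∣m))

-- Sieving by a finite set of primes

FreeOf : ∀ {K} → (Fin K → ℕ) → ℕ → Set
FreeOf q i = ∀ j → q j ∤ i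

freeOf? : ∀ {K} (q : Fin K → ℕ) → Decidable (FreeOf q)
freeOf? {zero} q i = yes λ ()
freeOf? {suc K} q i =
  map′ (uncurry Finₚ.∀-cons) (λ free → free Fin.zero , free ∘ Fin.suc) (¬? (head q ∣? i) ×-dec freeOf? (tail q) i)

sifted : ∀ {K} → (Fin K → ℕ) → ℕ → ℕ
sifted q = count (λ i → does (freeOf? q i))

freeOf-* : ∀ {K} (q : Fin K → ℕ) {r} → (∀ j → Prime (q j)) → Prime r → (∀ j → q j ≢ r)
         → ∀ i → does (freeOf? q (r * i)) ≡ does (freeOf? q i)
freeOf-* q {r} q-prime r-prime q≢r i = does-⇔ (mk⇔ to from) (freeOf? q (r * i)) (freeOf? q i)
  where
  to : FreeOf q (r * i) → FreeOf q i
  to free j qⱼ∣i = free j (∣n⇒∣m*n r qⱼ∣i)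
  from : FreeOf q i → FreeOf q (r * i)
  from free j qⱼ∣ri with euclidsLemma r i (q-prime j) qⱼ∣ri
  ... | inj₁ qⱼ∣r = q≢r j (prime∣prime⇒≡ (q-prime j) r-prime qⱼ∣r)
  ... | inj₂ qⱼ∣i = free j qⱼ∣i

sifted-step : ∀ {K} (q : Fin (suc K) → ℕ) (q-prime : ∀ j → Prime (q j)) → (∀ j → q (Fin.suc j) ≢ q Fin.zero)
            → ∀ x → let instance _ = prime⇒nonZero (q-prime Fin.zero) in
              sifted q x + sifted (tail q) (x / head q) ≡ sifted (tail q) x
sifted-step q q-prime q≢q₀ x = sym (begin
  count free x
    ≡⟨ count-split free r∣ x ⟩
  count (λ i → free i ∧ r∣ i) x + count (λ i → free i ∧ not (r∣ i)) x
    ≡⟨ +-comm (count (λ i → free i ∧ r∣ i) x) _ ⟩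
  count (λ i → free i ∧ not (r∣ i)) x + count (λ i → free i ∧ r∣ i) x
    ≡⟨ cong₂ _+_ (count-cong x (λ i _ _ → ∧-comm (free i) (not (r∣ i))))
                 (count-cong x (λ i _ _ → ∧-comm (free i) (r∣ i))) ⟩
  sifted q x + count (λ i → r∣ i ∧ free i) x
    ≡⟨ cong (_+_ (sifted q x)) (count-multiples free r x) ⟩
  sifted q x + count (λ j → free (r * j)) (x / r)
    ≡⟨ cong (_+_ (sifted q x))
            (count-cong (x / r) (λ i _ _ → freeOf-* (tail q) (q-prime ∘ Fin.suc) (q-prime Fin.zero) q≢q₀ i)) ⟩
  sifted q x + sifted (tail q) (x / r) ∎)
  where
  open ≡-Reasoning
  r = head q
  instance _ = prime⇒nonZero (q-prime Fin.zero)
  free = λ i → does (freeOf? (tail q) i)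
  r∣ = λ i → does (r ∣? i)

Δ₈ : ∀ {K} → (Fin K → ℕ) → ℕ → ℤ
Δ₈ q N = + sifted q N ℤ.- + 8 ℤ.* + sifted q (N / 8)

Δ₈-[] : ∀ (q : Fin 0 → ℕ) N → Δ₈ q N ≡ + (N % 8)
Δ₈-[] q N rewrite count-true N | count-true (N / 8) = begin
  + N ℤ.- + 8 ℤ.* + (N / 8)
    ≡⟨ cong (λ m → + m ℤ.- + 8 ℤ.* + (N / 8)) (m≡m%n+[m/n]*n N 8) ⟩
  + (N % 8 + N / 8 * 8) ℤ.- + 8 ℤ.* + (N / 8)
    ≡⟨ cong (λ z → z ℤ.- + 8 ℤ.* + (N / 8))
            (trans (ℤₚ.pos-+ (N % 8) _) (cong (ℤ._+_ (+ (N % 8))) (ℤₚ.pos-* (N / 8) 8))) ⟩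
  + (N % 8) ℤ.+ + (N / 8) ℤ.* + 8 ℤ.- + 8 ℤ.* + (N / 8)
    ≡⟨ solve 2 (λ r t → r :+ t :* con (+ 8) :- con (+ 8) :* t := r) refl (+ (N % 8)) (+ (N / 8)) ⟩
  + (N % 8) ∎
  where
  open ≡-Reasoning
  open +-*-Solver

Δ₈-step : ∀ {K} (q : Fin (suc K) → ℕ) (q-prime : ∀ j → Prime (q j)) → (∀ j → q (Fin.suc j) ≢ q Fin.zero)
        → ∀ N → let instance _ = prime⇒nonZero (q-prime Fin.zero) in
          Δ₈ q N ≡ Δ₈ (tail q) N ℤ.- Δ₈ (tail q) (N / head q)
Δ₈-step q q-prime q≢q₀ N = begin
  + a ℤ.- + 8 ℤ.* + b
    ≡⟨ solve 4 (λ a b c d → a :- con (+ 8) :* b := (a :+ c) :- con (+ 8) :* (b :+ d) :- (c :- con (+ 8) :* d))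
             refl (+ a) (+ b) (+ c) (+ d) ⟩
  (+ a ℤ.+ + c) ℤ.- + 8 ℤ.* (+ b ℤ.+ + d) ℤ.- (+ c ℤ.- + 8 ℤ.* + d)
    ≡⟨ cong₂ (λ u v → u ℤ.- + 8 ℤ.* v ℤ.- (+ c ℤ.- + 8 ℤ.* + d))
             (trans (sym (ℤₚ.pos-+ a c)) (cong +_ (sifted-step q q-prime q≢q₀ N)))
             (trans (sym (ℤₚ.pos-+ b d)) (cong +_ (sifted-step q q-prime q≢q₀ (N / 8)))) ⟩
  Δ₈ (tail q) N ℤ.- (+ c ℤ.- + 8 ℤ.* + d)
    ≡⟨ cong (λ m → Δ₈ (tail q) N ℤ.- (+ c ℤ.- + 8 ℤ.* + sifted (tail q) m)) /8/r≡/r/8 ⟩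
  Δ₈ (tail q) N ℤ.- Δ₈ (tail q) (N / r) ∎
  where
  open ≡-Reasoning
  open +-*-Solver
  r = head q
  instance _ = prime⇒nonZero (q-prime Fin.zero)
  instance _ = m*n≢0 8 r
  instance _ = m*n≢0 r 8
  a = sifted q N
  b = sifted q (N / 8)
  c = sifted (tail q) (N / r)
  d = sifted (tail q) (N / 8 / r)
  /8/r≡/r/8 : N / 8 / r ≡ N / r / 8
  /8/r≡/r/8 = trans (m/n/o≡m/[n*o] N 8 r) (trans (/-congʳ (*-comm 8 r)) (sym (m/n/o≡m/[n*o] N r 8)))

-- The Kronecker symbols (−4/·) and (−8/·), read off the residue mod 8.
χ₄-table χ₈-table : ℕ → ℤ
χ₄-table 1 = + 1
χ₄-table 3 = -[1+ 0 ]
χ₄-table 5 = + 1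
χ₄-table 7 = -[1+ 0 ]
χ₄-table _ = + 0
χ₈-table 1 = + 1
χ₈-table 3 = + 1
χ₈-table 5 = -[1+ 0 ]
χ₈-table 7 = -[1+ 0 ]
χ₈-table _ = + 0

χ₄ χ₈ : ℕ → ℤ
χ₄ n = χ₄-table (n % 8)
χ₈ n = χ₈-table (n % 8)

mod8-* : ∀ (table : ℕ → ℤ) → (∀ {r} → r < 8 → ∀ {s} → s < 8 → table (r * s % 8) ≡ table r ℤ.* table s)
       → ∀ a b → table (a * b % 8) ≡ table (a % 8) ℤ.* table (b % 8)
mod8-* table table-* a b = trans (cong table (%-distribˡ-* a b 8)) (table-* (m%n<n a 8) (m%n<n b 8))

χ₄-* : ∀ a b → χ₄ (a * b) ≡ χ₄ a ℤ.* χ₄ b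
χ₄-* = mod8-* χ₄-table
  (toWitness {a? = allUpTo? (λ r → allUpTo? (λ s → χ₄-table (r * s % 8) ℤ.≟ χ₄-table r ℤ.* χ₄-table s) 8) 8} _)

χ₈-* : ∀ a b → χ₈ (a * b) ≡ χ₈ a ℤ.* χ₈ b
χ₈-* = mod8-* χ₈-table
  (toWitness {a? = allUpTo? (λ r → allUpTo? (λ s → χ₈-table (r * s % 8) ℤ.≟ χ₈-table r ℤ.* χ₈-table s) 8) 8} _)

odd-residue : ∀ {P : ℕ → Set} → (∀ {r} → r < 8 → Odd r → P r) → ∀ m → Odd m → P (m % 8)
odd-residue P-odd m m-odd = P-odd (m%n<n m 8) (trans (m∣n⇒o%n%m≡o%m 2 8 m (divides 4 refl)) m-odd)

χ₄-odd² : ∀ m → Odd m → χ₄ m ℤ.* χ₄ m ≡ + 1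
χ₄-odd² = odd-residue (toWitness {a? = allUpTo? (λ r → odd? r →-dec (χ₄-table r ℤ.* χ₄-table r ℤ.≟ + 1)) 8} _)

χ₈-odd² : ∀ m → Odd m → χ₈ m ℤ.* χ₈ m ≡ + 1
χ₈-odd² = odd-residue (toWitness {a? = allUpTo? (λ r → odd? r →-dec (χ₈-table r ℤ.* χ₈-table r ℤ.≟ + 1)) 8} _)

χ₄-odd : ∀ m → Odd m → χ₄ m ≡ + 1 ⊎ (m % 8 ≡ 3 ⊎ m % 8 ≡ 7)
χ₄-odd = odd-residue (toWitness {a? = allUpTo? (λ r → odd? r →-dec (χ₄-table r ℤ.≟ + 1 ⊎-dec (r ≟ 3 ⊎-dec r ≟ 7))) 8} _)

χ₈-odd : ∀ m → Odd m → χ₈ m ≡ + 1 ⊎ (m % 8 ≡ 5 ⊎ m % 8 ≡ 7)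
χ₈-odd = odd-residue (toWitness {a? = allUpTo? (λ r → odd? r →-dec (χ₈-table r ℤ.≟ + 1 ⊎-dec (r ≟ 5 ⊎-dec r ≟ 7))) 8} _)

c₀ c₄ c₈ : ℕ → ℤ
c₀ 0 = + 4
c₀ 1 = + 4
c₀ 2 = + 4
c₀ _ = + 0
c₄ 0 = -[1+ 0 ]
c₄ 1 = -[1+ 1 ]
c₄ _ = + 0
c₈ 0 = -[1+ 1 ]
c₈ _ = + 0

2^β*odd%8-β<3 : ∀ {β} → β < 3 → ∀ M → Odd M → + (2 ^ β * M % 8) ≡ c₀ β ℤ.+ c₄ β ℤ.* χ₄ M ℤ.+ c₈ β ℤ.* χ₈ M
2^β*odd%8-β<3 {β} β<3 M M-odd = trans (cong +_ (%-distribˡ-* (2 ^ β) M 8)) (odd-residue (table β<3) M M-odd)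
  where
  table : ∀ {β} → β < 3 → ∀ {r} → r < 8 → Odd r
        → + (2 ^ β % 8 * r % 8) ≡ c₀ β ℤ.+ c₄ β ℤ.* χ₄-table r ℤ.+ c₈ β ℤ.* χ₈-table r
  table = toWitness {a? = allUpTo? (λ β → allUpTo? (λ r → odd? r →-dec
            (+ (2 ^ β % 8 * r % 8) ℤ.≟ c₀ β ℤ.+ c₄ β ℤ.* χ₄-table r ℤ.+ c₈ β ℤ.* χ₈-table r)) 8) 3} _

2^β*odd%8 : ∀ β M → Odd M → + (2 ^ β * M % 8) ≡ c₀ β ℤ.+ c₄ β ℤ.* χ₄ M ℤ.+ c₈ β ℤ.* χ₈ M
2^β*odd%8 0 = 2^β*odd%8-β<3 z<s
2^β*odd%8 1 = 2^β*odd%8-β<3 (s<s z<s)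
2^β*odd%8 2 = 2^β*odd%8-β<3 (s<s (s<s z<s))
2^β*odd%8 (suc (suc (suc β))) M _ = cong +_ (trans (cong (_% 8) 2^[3+β]*M≡) (m*n%n≡0 (2 ^ β * M) 8))
  where
  open ℕ-Solver.+-*-Solver
  2^[3+β]*M≡ : 2 ^ suc (suc (suc β)) * M ≡ 2 ^ β * M * 8
  2^[3+β]*M≡ = solve 2 (λ x m → (con 2 :* (con 2 :* (con 2 :* x))) :* m := x :* m :* con 8) refl (2 ^ β) M

∏[1-_]_ : ∀ {K} → (ℕ → ℤ) → (Fin K → ℕ) → ℤ
∏[1- χ ] q = foldr (λ m → (+ 1 ℤ.- χ m) ℤ.*_) (+ 1) q

∏[1-]-all-neg : ∀ {K} χ (q : Fin K → ℕ) → (∀ j → χ (q j) ≡ -1ℤ) → ∏[1- χ ] q ≡ (+ 2) ℤ.^ K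
∏[1-]-all-neg {zero} χ q χq≡-1 = refl
∏[1-]-all-neg {suc K} χ q χq≡-1 =
  cong₂ (λ x y → (+ 1 ℤ.- x) ℤ.* y) (χq≡-1 Fin.zero) (∏[1-]-all-neg χ (tail q) (χq≡-1 ∘ Fin.suc))

∏[1-]-some-pos : ∀ {K} χ (q : Fin K → ℕ) → (∃ λ j → χ (q j) ≡ + 1) → ∏[1- χ ] q ≡ + 0
∏[1-]-some-pos χ q (Fin.zero , χq≡1) = cong (λ x → (+ 1 ℤ.- x) ℤ.* ∏[1- χ ] tail q) χq≡1
∏[1-]-some-pos χ q (Fin.suc j , χq≡1) =
  trans (cong ((+ 1 ℤ.- χ (head q)) ℤ.*_) (∏[1-]-some-pos χ (tail q) (j , χq≡1))) (ℤₚ.*-zeroʳ (+ 1 ℤ.- χ (head q)))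

module CompletelyMultiplicative (χ : ℕ → ℤ) (χ-1 : χ 1 ≡ + 1) (χ-* : ∀ a b → χ (a * b) ≡ χ a ℤ.* χ b) where

  χ-/ : ∀ {q M} .{{_ : NonZero q}} → χ q ℤ.* χ q ≡ + 1 → q ∣ M → χ (M / q) ≡ χ q ℤ.* χ M
  χ-/ {q} {M} χq²≡1 q∣M = begin
    χ (M / q)                     ≡⟨ ℤₚ.*-identityˡ _ ⟨
    + 1 ℤ.* χ (M / q)             ≡⟨ cong (ℤ._* χ (M / q)) χq²≡1 ⟨
    χ q ℤ.* χ q ℤ.* χ (M / q)     ≡⟨ ℤₚ.*-assoc (χ q) _ _ ⟩
    χ q ℤ.* (χ q ℤ.* χ (M / q))   ≡⟨ cong (χ q ℤ.*_) (χ-* q (M / q)) ⟨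
    χ q ℤ.* χ (q * (M / q))       ≡⟨ cong (λ m → χ q ℤ.* χ m) (m*[n/m]≡n q∣M) ⟩
    χ q ℤ.* χ M                   ∎
    where open ≡-Reasoning

  χ-^ : ∀ {x} → χ x ≡ -1ℤ → ∀ a → χ (x ^ a) ≡ -1ℤ ℤ.^ a
  χ-^ χx≡-1 zero = χ-1
  χ-^ {x} χx≡-1 (suc a) = trans (χ-* x (x ^ a)) (cong₂ ℤ._*_ χx≡-1 (χ-^ χx≡-1 a))

  χ-∏ : ∀ K (q a : Fin K → ℕ) → (∀ j → χ (q j) ≡ -1ℤ) → χ (∏ K (λ j → q j ^ a j)) ≡ -1ℤ ℤ.^ ∑ a
  χ-∏ zero q a _ = χ-1
  χ-∏ (suc K) q a χq≡-1 = begin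
    χ (head q ^ head a * ∏ K (λ j → tail q j ^ tail a j))
      ≡⟨ χ-* (head q ^ head a) _ ⟩
    χ (head q ^ head a) ℤ.* χ (∏ K (λ j → tail q j ^ tail a j))
      ≡⟨ cong₂ ℤ._*_ (χ-^ (χq≡-1 Fin.zero) (head a)) (χ-∏ K (tail q) (tail a) (χq≡-1 ∘ Fin.suc)) ⟩
    -1ℤ ℤ.^ head a ℤ.* -1ℤ ℤ.^ ∑ (tail a)
      ≡⟨ ℤₚ.^-distribˡ-+-* -1ℤ (head a) (∑ (tail a)) ⟨
    -1ℤ ℤ.^ ∑ a ∎
    where open ≡-Reasoning

module χ₄ = CompletelyMultiplicative χ₄ refl χ₄-*
module χ₈ = CompletelyMultiplicative χ₈ refl χ₈-*

Δ₈-2^β* : ∀ {K} (q : Fin K → ℕ) → (∀ j → Prime (q j)) → Injective _≡_ _≡_ q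
        → ∀ β {M} → Odd M → (∀ j → q j ∣ M)
        → Δ₈ q (2 ^ β * M) ≡ c₀ β ℤ.* ℤ.0ℤ ℤ.^ K
                             ℤ.+ c₄ β ℤ.* χ₄ M ℤ.* ∏[1- χ₄ ] q ℤ.+ c₈ β ℤ.* χ₈ M ℤ.* ∏[1- χ₈ ] q
Δ₈-2^β* {zero} q _ _ β {M} M-odd _ = begin
  Δ₈ q (2 ^ β * M)                                       ≡⟨ Δ₈-[] q (2 ^ β * M) ⟩
  + (2 ^ β * M % 8)                                      ≡⟨ 2^β*odd%8 β M M-odd ⟩
  c₀ β ℤ.+ c₄ β ℤ.* χ₄ M ℤ.+ c₈ β ℤ.* χ₈ M
    ≡⟨ solve 5 (λ a b c x y → a :+ b :* x :+ c :* y := a :* con (+ 1) :+ b :* x :* con (+ 1) :+ c :* y :* con (+ 1))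
             refl (c₀ β) (c₄ β) (c₈ β) (χ₄ M) (χ₈ M) ⟩
  c₀ β ℤ.* + 1 ℤ.+ c₄ β ℤ.* χ₄ M ℤ.* + 1 ℤ.+ c₈ β ℤ.* χ₈ M ℤ.* + 1 ∎
  where
  open ≡-Reasoning
  open +-*-Solver
Δ₈-2^β* {suc K} q q-prime q-inj β {M} M-odd q∣M = begin
  Δ₈ q (2 ^ β * M)
    ≡⟨ Δ₈-step q q-prime (λ j → Finₚ.0≢1+n ∘ sym ∘ q-inj) (2 ^ β * M) ⟩
  Δ₈ (tail q) (2 ^ β * M) ℤ.- Δ₈ (tail q) (2 ^ β * M / r)
    ≡⟨ cong (λ N → Δ₈ (tail q) (2 ^ β * M) ℤ.- Δ₈ (tail q) N) (*-/-assoc (2 ^ β) r∣M) ⟩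
  Δ₈ (tail q) (2 ^ β * M) ℤ.- Δ₈ (tail q) (2 ^ β * (M / r))
    ≡⟨ cong₂ ℤ._-_ (Δ₈-2^β* (tail q) (q-prime ∘ Fin.suc) tail-inj β M-odd (q∣M ∘ Fin.suc))
                   (Δ₈-2^β* (tail q) (q-prime ∘ Fin.suc) tail-inj β (odd-∣ M-odd (m/n∣m r∣M)) q∣M/r) ⟩
  formula (χ₄ M) (χ₈ M) ℤ.- formula (χ₄ (M / r)) (χ₈ (M / r))
    ≡⟨ cong₂ (λ x y → formula (χ₄ M) (χ₈ M) ℤ.- formula x y)
             (χ₄.χ-/ (χ₄-odd² r r-odd) r∣M) (χ₈.χ-/ (χ₈-odd² r r-odd) r∣M) ⟩
  formula (χ₄ M) (χ₈ M) ℤ.- formula (χ₄ r ℤ.* χ₄ M) (χ₈ r ℤ.* χ₈ M)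
    ≡⟨ solve 10 (λ a b c x y u v Z P₄ P₈ →
                  (a :* Z :+ b :* x :* P₄ :+ c :* y :* P₈) :- (a :* Z :+ b :* (u :* x) :* P₄ :+ c :* (v :* y) :* P₈)
               := a :* (con ℤ.0ℤ :* Z) :+ b :* x :* ((con (+ 1) :- u) :* P₄) :+ c :* y :* ((con (+ 1) :- v) :* P₈))
             refl (c₀ β) (c₄ β) (c₈ β) (χ₄ M) (χ₈ M) (χ₄ r) (χ₈ r) (ℤ.0ℤ ℤ.^ K) (∏[1- χ₄ ] tail q) (∏[1- χ₈ ] tail q) ⟩
  c₀ β ℤ.* ℤ.0ℤ ℤ.^ suc K ℤ.+ c₄ β ℤ.* χ₄ M ℤ.* ∏[1- χ₄ ] q ℤ.+ c₈ β ℤ.* χ₈ M ℤ.* ∏[1- χ₈ ] q ∎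
  where
  open ≡-Reasoning
  open +-*-Solver
  r = head q
  instance _ = prime⇒nonZero (q-prime Fin.zero)
  r∣M = q∣M Fin.zero
  r-odd = odd-∣ M-odd r∣M
  tail-inj : Injective _≡_ _≡_ (tail q)
  tail-inj = Finₚ.suc-injective ∘ q-inj
  q∣M/r : ∀ j → tail q j ∣ M / r
  q∣M/r j with euclidsLemma r (M / r) (q-prime (Fin.suc j))
                            (subst (tail q j ∣_) (sym (m*[n/m]≡n r∣M)) (q∣M (Fin.suc j)))
  ... | inj₁ qⱼ∣r = ⊥-elim (Finₚ.0≢1+n (sym (q-inj (prime∣prime⇒≡ (q-prime (Fin.suc j)) (q-prime Fin.zero) qⱼ∣r))))
  ... | inj₂ qⱼ∣M/r = qⱼ∣M/r
  formula : ℤ → ℤ → ℤ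
  formula x y = c₀ β ℤ.* ℤ.0ℤ ℤ.^ K ℤ.+ c₄ β ℤ.* x ℤ.* ∏[1- χ₄ ] tail q ℤ.+ c₈ β ℤ.* y ℤ.* ∏[1- χ₈ ] tail q

record DistinctPrimePowers {K} (q b : Fin K → ℕ) : Set where
  field
    prime : ∀ j → Prime (q j)
    injective : Injective _≡_ _≡_ q
    exponent-pos : ∀ j → 1 ≤ b j

module _ {K} {q b : Fin K → ℕ} (fam : DistinctPrimePowers q b) where

  open DistinctPrimePowers fam

  private
    n = ∏ K (λ j → q j ^ b j)

    qʲ^bʲ∣n : ∀ j → q j ^ b j ∣ n
    qʲ^bʲ∣n = ∏-factor-∣ K (λ j → q j ^ b j)

  q∣n : ∀ j → q j ∣ n
  q∣n j = ∣-trans (subst (λ e → q j ∣ q j ^ e) (suc-pred (b j) {{ℕ.>-nonZero (exponent-pos j)}}) (m∣m*n _)) (qʲ^bʲ∣n j)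

  private
    instance _ = λ {j} → prime⇒nonZero (prime j)

    1≤n : 1 ≤ n
    1≤n = ∏-pos K (λ j → q j ^ b j) (λ j → m^n>0 (q j) (b j))

    instance _ = ℕ.>-nonZero 1≤n

    q≤n : ∀ j → q j ≤ n
    q≤n j = ∣⇒≤ (q∣n j)

    1≤q : ∀ j → 1 ≤ q j
    1≤q j = ℕ.>-nonZero⁻¹ (q j)

    b≤n : ∀ j → b j ≤ n
    b≤n j = ≤-trans (<⇒≤ (n<m^n (nonTrivial⇒n>1 (q j) {{prime⇒nonTrivial (prime j)}}) (b j))) (∣⇒≤ (qʲ^bʲ∣n j))

    prime∣n⇒∈q : ∀ {p} → Prime p → p ∣ n → ∃ λ j → p ≡ q j
    prime∣n⇒∈q = prime∣∏⇒≡ K q b prime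

    ∉q : ∀ {p} → ¬ (Prime p × p ∣ n) → ∀ j → p ≢ q j
    ∉q ¬p j refl = ¬p (prime j , q∣n j)

  φ[e]≡sifted : ∀ e .{{_ : NonZero e}} → φ[ e ] n ≡ sifted q (n / e)
  φ[e]≡sifted e = trans (length-filter-[1‥] (λ i → gcd i n ≟ 1) (n / e))
                         (count-cong (n / e) (λ i _ _ →
                           does-⇔ (mk⇔ coprime⇒free free⇒coprime) (gcd i n ≟ 1) (freeOf? q i)))
    where
    coprime⇒free : ∀ {i} → gcd i n ≡ 1 → FreeOf q i
    coprime⇒free gcd≡1 j qⱼ∣i = ¬prime[1] (subst Prime (gcd≡1⇒coprime gcd≡1 (qⱼ∣i , q∣n j)) (prime j))
    free⇒coprime : ∀ {i} → FreeOf q i → gcd i n ≡ 1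
    free⇒coprime free = coprime⇒gcd≡1 (coprime-∏ K q b prime free)

  φ≡sifted : φ n ≡ sifted q n
  φ≡sifted = trans (φ[e]≡sifted 1) (cong (sifted q) (n/1≡n n))

  φ-8φ₈≡Δ₈ : + φ n ℤ.- + 8 ℤ.* + φ[ 8 ] n ≡ Δ₈ q n
  φ-8φ₈≡Δ₈ = cong₂ (λ x y → + x ℤ.- + 8 ℤ.* + y) φ≡sifted (φ[e]≡sifted 8)

  ω≡K : ω n ≡ K
  ω≡K = begin
    ω n                                          ≡⟨ length-filter-[1‥] (λ p → prime? p ×-dec p ∣? n) n ⟩
    count (λ p → does (prime? p ×-dec p ∣? n)) n ≡⟨ sumUpTo-cong n (λ p _ _ → indicator (prime? p ×-dec p ∣? n)) ⟩
    sumUpTo (λ p → ∑ (λ j → δ p (q j) * 1)) n    ≡⟨ sumUpTo-∑ (λ j p → δ p (q j) * 1) n ⟩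
    ∑ (λ j → sumUpTo (λ p → δ p (q j) * 1) n)    ≡⟨ ∑-cong (λ j → sumUpTo-δ (q j) 1 n (1≤q j) (q≤n j)) ⟩
    ∑ {K} (λ _ → 1)                              ≡⟨ ∑-const-1 K ⟩
    K                                            ∎
    where
    open ≡-Reasoning
    indicator : ∀ {p} (d : Dec (Prime p × p ∣ n)) → iverson (does d) ≡ ∑ (λ j → δ p (q j) * 1)
    indicator (yes (p-prime , p∣n)) with prime∣n⇒∈q p-prime p∣n
    ... | j , p≡qⱼ = sym (∑-select q (λ _ → 1) injective j p≡qⱼ)
    indicator {p} (no ¬p) = sym (∑-select-none q (λ _ → 1) p (∉q ¬p))

  Ω≡∑b : Ω n ≡ ∑ b
  Ω≡∑b = begin
    Ω n
      ≡⟨ length-filter-[1‥]² (λ (p , y) → prime? p ×-dec (p ^ y) ∣? n) n n ⟩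
    sumUpTo (λ p → count (λ y → does (prime? p ×-dec (p ^ y) ∣? n)) n) n
      ≡⟨ sumUpTo-cong n (λ p _ _ → multiplicity (prime? p ×-dec p ∣? n)) ⟩
    sumUpTo (λ p → ∑ (λ j → δ p (q j) * b j)) n
      ≡⟨ sumUpTo-∑ (λ j p → δ p (q j) * b j) n ⟩
    ∑ (λ j → sumUpTo (λ p → δ p (q j) * b j) n)
      ≡⟨ ∑-cong (λ j → sumUpTo-δ (q j) (b j) n (1≤q j) (q≤n j)) ⟩
    ∑ b ∎
    where
    open ≡-Reasoning
    multiplicity : ∀ {p} (d : Dec (Prime p × p ∣ n))
                 → count (λ y → does (prime? p ×-dec (p ^ y) ∣? n)) n ≡ ∑ (λ j → δ p (q j) * b j)
    multiplicity (yes (p-prime , p∣n)) with prime∣n⇒∈q p-prime p∣n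
    ... | j , refl = begin
      count (λ y → does (prime? (q j) ×-dec (q j ^ y) ∣? n)) n
        ≡⟨ count-cong n (λ y _ _ → does-⇔ (mk⇔ (λ (_ , qʲ^y∣n) → prime^∣∏⇒≤ K q b prime injective j y qʲ^y∣n)
                                                (λ y≤bⱼ → p-prime , ∣-trans (^-∣-^ (q j) y≤bⱼ) (qʲ^bʲ∣n j)))
                                          (prime? (q j) ×-dec (q j ^ y) ∣? n) (y ≤? b j)) ⟩
      count (λ y → does (y ≤? b j)) n ≡⟨ count-≤ (b j) n ⟩
      n ⊓ b j                         ≡⟨ m≥n⇒m⊓n≡n (b≤n j) ⟩
      b j                             ≡⟨ ∑-select q b injective j refl ⟨
      ∑ (λ i → δ (q j) (q i) * b i)   ∎
    multiplicity {p} (no ¬p) =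
      trans (sumUpTo-zero _ n (λ y 1≤y _ → cong iverson (dec-false (prime? p ×-dec (p ^ y) ∣? n) (¬pʸ 1≤y))))
            (sym (∑-select-none q b p (∉q ¬p)))
      where
      ¬pʸ : ∀ {y} → 1 ≤ y → ¬ (Prime p × p ^ y ∣ n)
      ¬pʸ {suc y} _ (p-prime , pʸ∣n) = ¬p (p-prime , ∣-trans (m∣m*n (p ^ y)) pʸ∣n)

-- n = 2^α M with M odd

-- Sieving out the prime 2 of n = 2^α M replaces each coefficient c(α) by c(α) − c(α − 1).
d₄ d₈ : ℕ → ℤ
d₄ zero = c₄ zero
d₄ (suc β) = c₄ (suc β) ℤ.- c₄ β
d₈ zero = c₈ zero
d₈ (suc β) = c₈ (suc β) ℤ.- c₈ β

module _ {k} {p a : Fin k → ℕ} (fam : DistinctPrimePowers p a) (p-odd : ∀ i → Odd (p i)) (1≤k : 1 ≤ k) where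

  open DistinctPrimePowers fam

  private
    M = ∏ k (λ i → p i ^ a i)

    2≢p : ∀ i → 2 ≢ p i
    2≢p i 2≡pᵢ = odd⇒2∤ (p-odd i) (subst (2 ∣_) 2≡pᵢ ∣-refl)

    M-odd : Odd M
    M-odd = 2∤⇒odd λ 2∣M → let (i , 2≡pᵢ) = prime∣∏⇒≡ k p a prime prime[2] 2∣M in 2≢p i 2≡pᵢ

    with-2 : ∀ α → DistinctPrimePowers (2 Vec.∷ p) (suc α Vec.∷ a)
    with-2 α = record
      { prime = λ { Fin.zero → prime[2] ; (Fin.suc i) → prime i }
      ; injective = inj
      ; exponent-pos = λ { Fin.zero → s≤s z≤n ; (Fin.suc i) → exponent-pos i }
      }
      where
      inj : Injective _≡_ _≡_ (2 Vec.∷ p)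
      inj {Fin.zero} {Fin.zero} _ = refl
      inj {Fin.zero} {Fin.suc j} 2≡pⱼ = ⊥-elim (2≢p j 2≡pⱼ)
      inj {Fin.suc i} {Fin.zero} pᵢ≡2 = ⊥-elim (2≢p i (sym pᵢ≡2))
      inj {Fin.suc i} {Fin.suc j} pᵢ≡pⱼ = cong Fin.suc (injective pᵢ≡pⱼ)

    Δ₈-2^β*M : ∀ β → Δ₈ p (2 ^ β * M) ≡ c₄ β ℤ.* χ₄ M ℤ.* ∏[1- χ₄ ] p ℤ.+ c₈ β ℤ.* χ₈ M ℤ.* ∏[1- χ₈ ] p
    Δ₈-2^β*M β = begin
      Δ₈ p (2 ^ β * M)                             ≡⟨ Δ₈-2^β* p prime injective β M-odd (q∣n fam) ⟩
      c₀ β ℤ.* ℤ.0ℤ ℤ.^ k ℤ.+ A ℤ.+ B              ≡⟨ cong (λ Z → c₀ β ℤ.* Z ℤ.+ A ℤ.+ B) (0ℤ^-pos 1≤k) ⟩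
      c₀ β ℤ.* ℤ.0ℤ ℤ.+ A ℤ.+ B
        ≡⟨ solve 3 (λ c a b → c :* con ℤ.0ℤ :+ a :+ b := a :+ b) refl (c₀ β) A B ⟩
      A ℤ.+ B                                      ∎
      where
      open ≡-Reasoning
      open +-*-Solver
      A = c₄ β ℤ.* χ₄ M ℤ.* ∏[1- χ₄ ] p
      B = c₈ β ℤ.* χ₈ M ℤ.* ∏[1- χ₈ ] p
      0ℤ^-pos : ∀ {k} → 1 ≤ k → ℤ.0ℤ ℤ.^ k ≡ ℤ.0ℤ
      0ℤ^-pos {suc k} _ = refl

  ω-2^α* : ∀ α → ω (2 ^ α * M) ≡ α ⊓ 1 + k
  ω-2^α* zero = trans (cong ω (*-identityˡ M)) (ω≡K fam)
  ω-2^α* (suc α) = trans (ω≡K (with-2 α)) (cong (λ m → suc m + k) (sym (⊓-zeroʳ α)))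

  Ω-2^α* : ∀ α → Ω (2 ^ α * M) ≡ α + ∑ a
  Ω-2^α* zero = trans (cong Ω (*-identityˡ M)) (Ω≡∑b fam)
  Ω-2^α* (suc α) = Ω≡∑b (with-2 α)

  φ-8φ₈ : ∀ α → + φ (2 ^ α * M) ℤ.- + 8 ℤ.* + φ[ 8 ] (2 ^ α * M)
                        ≡ d₄ α ℤ.* χ₄ M ℤ.* ∏[1- χ₄ ] p ℤ.+ d₈ α ℤ.* χ₈ M ℤ.* ∏[1- χ₈ ] p
  φ-8φ₈ zero = begin
    + φ (1 * M) ℤ.- + 8 ℤ.* + φ[ 8 ] (1 * M) ≡⟨ cong (λ n → + φ n ℤ.- + 8 ℤ.* + φ[ 8 ] n) (*-identityˡ M) ⟩
    + φ M ℤ.- + 8 ℤ.* + φ[ 8 ] M             ≡⟨ φ-8φ₈≡Δ₈ fam ⟩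
    Δ₈ p M                                   ≡⟨ cong (Δ₈ p) (*-identityˡ M) ⟨
    Δ₈ p (1 * M)                             ≡⟨ Δ₈-2^β*M 0 ⟩
    d₄ 0 ℤ.* χ₄ M ℤ.* ∏[1- χ₄ ] p ℤ.+ d₈ 0 ℤ.* χ₈ M ℤ.* ∏[1- χ₈ ] p ∎
    where open ≡-Reasoning
  φ-8φ₈ (suc α) = begin
    + φ n ℤ.- + 8 ℤ.* + φ[ 8 ] n
      ≡⟨ φ-8φ₈≡Δ₈ (with-2 α) ⟩
    Δ₈ (2 Vec.∷ p) n
      ≡⟨ Δ₈-step (2 Vec.∷ p) (DistinctPrimePowers.prime (with-2 α)) (λ j → 2≢p j ∘ sym) n ⟩
    Δ₈ p n ℤ.- Δ₈ p (n / 2)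
      ≡⟨ cong (λ m → Δ₈ p n ℤ.- Δ₈ p m) n/2≡ ⟩
    Δ₈ p (2 ^ suc α * M) ℤ.- Δ₈ p (2 ^ α * M)
      ≡⟨ cong₂ ℤ._-_ (Δ₈-2^β*M (suc α)) (Δ₈-2^β*M α) ⟩
    (c₄ (suc α) ℤ.* X₄ ℤ.* P₄ ℤ.+ c₈ (suc α) ℤ.* X₈ ℤ.* P₈) ℤ.- (c₄ α ℤ.* X₄ ℤ.* P₄ ℤ.+ c₈ α ℤ.* X₈ ℤ.* P₈)
      ≡⟨ solve 8 (λ a a′ b b′ x P y Q → (a′ :* x :* P :+ b′ :* y :* Q) :- (a :* x :* P :+ b :* y :* Q)
                                      := (a′ :- a) :* x :* P :+ (b′ :- b) :* y :* Q)
               refl (c₄ α) (c₄ (suc α)) (c₈ α) (c₈ (suc α)) X₄ P₄ X₈ P₈ ⟩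
    d₄ (suc α) ℤ.* X₄ ℤ.* P₄ ℤ.+ d₈ (suc α) ℤ.* X₈ ℤ.* P₈ ∎
    where
    open ≡-Reasoning
    open +-*-Solver
    n = 2 ^ suc α * M
    X₄ = χ₄ M
    X₈ = χ₈ M
    P₄ = ∏[1- χ₄ ] p
    P₈ = ∏[1- χ₈ ] p
    n/2≡ : n / 2 ≡ 2 ^ α * M
    n/2≡ = trans (cong (_/ 2) (trans (*-assoc 2 (2 ^ α) M) (*-comm 2 (2 ^ α * M)))) (m*n/n≡m (2 ^ α * M) 2)

  private
    s = -1ℤ ℤ.^ ∑ a
    T = (+ 2) ℤ.^ k

    χ₄M≡s : (∀ i → χ₄ (p i) ≡ -1ℤ) → χ₄ M ≡ s
    χ₄M≡s = χ₄.χ-∏ k p a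

    χ₈M≡s : (∀ i → χ₈ (p i) ≡ -1ℤ) → χ₈ M ≡ s
    χ₈M≡s = χ₈.χ-∏ k p a

  φ-8φ₈-χ₈-neg : ∀ α → α ≤ 1 → (∀ i → χ₈ (p i) ≡ -1ℤ) → (∃ λ i → χ₄ (p i) ≡ + 1)
               → let n = 2 ^ α * M in
                 + φ n ℤ.- + 8 ℤ.* + φ[ 8 ] n ≡ -[1+ 1 ] ℤ.* -1ℤ ℤ.^ Ω n ℤ.* (+ 2) ℤ.^ (ω n ∸ α)
  φ-8φ₈-χ₈-neg α α≤1 χ₈≡-1 χ₄≡1
    rewrite φ-8φ₈ α | Ω-2^α* α | ω-2^α* α
          | ∏[1-]-some-pos χ₄ p χ₄≡1 | χ₈M≡s χ₈≡-1 | ∏[1-]-all-neg χ₈ p χ₈≡-1 = by-α α α≤1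
    where
    open +-*-Solver
    by-α : ∀ α → α ≤ 1 → d₄ α ℤ.* χ₄ M ℤ.* + 0 ℤ.+ d₈ α ℤ.* s ℤ.* T
                         ≡ -[1+ 1 ] ℤ.* -1ℤ ℤ.^ (α + ∑ a) ℤ.* (+ 2) ℤ.^ (α ⊓ 1 + k ∸ α)
    by-α 0 _ = solve 3 (λ x σ τ → con (d₄ 0) :* x :* con (+ 0) :+ con (d₈ 0) :* σ :* τ
                                  := con -[1+ 1 ] :* σ :* τ)
                       refl (χ₄ M) s T
    by-α 1 _ = solve 3 (λ x σ τ → con (d₄ 1) :* x :* con (+ 0) :+ con (d₈ 1) :* σ :* τ
                                  := con -[1+ 1 ] :* (con -1ℤ :* σ) :* τ)
                       refl (χ₄ M) s T
    by-α (suc (suc _)) (s≤s ())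

  φ-8φ₈-χ₄-neg : ∀ α → α ≤ 2 → (∀ i → χ₄ (p i) ≡ -1ℤ) → (∃ λ i → χ₈ (p i) ≡ + 1)
               → let n = 2 ^ α * M in
                 + φ n ℤ.- + 8 ℤ.* + φ[ 8 ] n ≡ -1ℤ ℤ.* -1ℤ ℤ.^ (Ω n ∸ ((α + 1) / 2)) ℤ.* (+ 2) ℤ.^ (ω n ∸ (α % 2))
  φ-8φ₈-χ₄-neg α α≤2 χ₄≡-1 χ₈≡1
    rewrite φ-8φ₈ α | Ω-2^α* α | ω-2^α* α
          | χ₄M≡s χ₄≡-1 | ∏[1-]-all-neg χ₄ p χ₄≡-1 | ∏[1-]-some-pos χ₈ p χ₈≡1 = by-α α α≤2
    where
    open +-*-Solver
    by-α : ∀ α → α ≤ 2 → d₄ α ℤ.* s ℤ.* T ℤ.+ d₈ α ℤ.* χ₈ M ℤ.* + 0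
                         ≡ -1ℤ ℤ.* -1ℤ ℤ.^ (α + ∑ a ∸ ((α + 1) / 2)) ℤ.* (+ 2) ℤ.^ (α ⊓ 1 + k ∸ (α % 2))
    by-α 0 _ = solve 3 (λ x σ τ → con (d₄ 0) :* σ :* τ :+ con (d₈ 0) :* x :* con (+ 0) := con -1ℤ :* σ :* τ)
                       refl (χ₈ M) s T
    by-α 1 _ = solve 3 (λ x σ τ → con (d₄ 1) :* σ :* τ :+ con (d₈ 1) :* x :* con (+ 0) := con -1ℤ :* σ :* τ)
                       refl (χ₈ M) s T
    by-α 2 _ = solve 3 (λ x σ τ → con (d₄ 2) :* σ :* τ :+ con (d₈ 2) :* x :* con (+ 0)
                                  := con -1ℤ :* (con -1ℤ :* σ) :* (con (+ 2) :* τ))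
                       refl (χ₈ M) s T
    by-α (suc (suc (suc _))) (s≤s (s≤s ()))

  φ-8φ₈-χ₄χ₈-neg : ∀ α → α ≤ 2 → (∀ i → χ₄ (p i) ≡ -1ℤ) → (∀ i → χ₈ (p i) ≡ -1ℤ)
                 → let n = 2 ^ α * M in
                   + φ n ℤ.- + 8 ℤ.* + φ[ 8 ] n ≡ -1ℤ ℤ.* -1ℤ ℤ.^ (Ω n ∸ (α / 2)) ℤ.* (+ 2) ℤ.^ (ω n ∸ (α % 2))
                                                  ℤ.+ -[1+ 1 ] ℤ.* (+ 1 ℤ.- + ((α + 1) / 2)) ℤ.* -1ℤ ℤ.^ Ω n ℤ.* (+ 2) ℤ.^ ω n
  φ-8φ₈-χ₄χ₈-neg α α≤2 χ₄≡-1 χ₈≡-1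
    rewrite φ-8φ₈ α | Ω-2^α* α | ω-2^α* α
          | χ₄M≡s χ₄≡-1 | ∏[1-]-all-neg χ₄ p χ₄≡-1 | χ₈M≡s χ₈≡-1 | ∏[1-]-all-neg χ₈ p χ₈≡-1 = by-α α α≤2
    where
    open +-*-Solver
    by-α : ∀ α → α ≤ 2 → d₄ α ℤ.* s ℤ.* T ℤ.+ d₈ α ℤ.* s ℤ.* T
                         ≡ -1ℤ ℤ.* -1ℤ ℤ.^ (α + ∑ a ∸ (α / 2)) ℤ.* (+ 2) ℤ.^ (α ⊓ 1 + k ∸ (α % 2))
                           ℤ.+ -[1+ 1 ] ℤ.* (+ 1 ℤ.- + ((α + 1) / 2)) ℤ.* -1ℤ ℤ.^ (α + ∑ a) ℤ.* (+ 2) ℤ.^ (α ⊓ 1 + k)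
    by-α 0 _ = solve 2 (λ σ τ → con (d₄ 0) :* σ :* τ :+ con (d₈ 0) :* σ :* τ
                                := con -1ℤ :* σ :* τ :+ con -[1+ 1 ] :* con (+ 1) :* σ :* τ)
                       refl s T
    by-α 1 _ = solve 2 (λ σ τ → con (d₄ 1) :* σ :* τ :+ con (d₈ 1) :* σ :* τ
                                := con -1ℤ :* (con -1ℤ :* σ) :* τ
                                   :+ con -[1+ 1 ] :* con (+ 0) :* (con -1ℤ :* σ) :* (con (+ 2) :* τ))
                       refl s T
    by-α 2 _ = solve 2 (λ σ τ → con (d₄ 2) :* σ :* τ :+ con (d₈ 2) :* σ :* τ
                                := con -1ℤ :* (con -1ℤ :* σ) :* (con (+ 2) :* τ)
                                   :+ con -[1+ 1 ] :* con (+ 0) :* (con -1ℤ :* (con -1ℤ :* σ)) :* (con (+ 2) :* τ))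
                       refl s T
    by-α (suc (suc (suc _))) (s≤s (s≤s ()))

  φ-8φ₈-otherwise : ∀ α → (α ≤ 2 → ∃ λ i → χ₄ (p i) ≡ + 1) → (α ≤ 1 → ∃ λ i → χ₈ (p i) ≡ + 1)
                  → let n = 2 ^ α * M in + φ n ℤ.- + 8 ℤ.* + φ[ 8 ] n ≡ + 0
  φ-8φ₈-otherwise α some₄ some₈ = trans (φ-8φ₈ α) (by-α α some₄ some₈)
    where
    open +-*-Solver
    by-α : ∀ α → (α ≤ 2 → ∃ λ i → χ₄ (p i) ≡ + 1) → (α ≤ 1 → ∃ λ i → χ₈ (p i) ≡ + 1)
         → d₄ α ℤ.* χ₄ M ℤ.* ∏[1- χ₄ ] p ℤ.+ d₈ α ℤ.* χ₈ M ℤ.* ∏[1- χ₈ ] p ≡ + 0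
    by-α 0 some₄ some₈
      rewrite ∏[1-]-some-pos χ₄ p (some₄ z≤n) | ∏[1-]-some-pos χ₈ p (some₈ z≤n) =
      solve 2 (λ x y → con (d₄ 0) :* x :* con (+ 0) :+ con (d₈ 0) :* y :* con (+ 0) := con (+ 0)) refl (χ₄ M) (χ₈ M)
    by-α 1 some₄ some₈
      rewrite ∏[1-]-some-pos χ₄ p (some₄ (s≤s z≤n)) | ∏[1-]-some-pos χ₈ p (some₈ (s≤s z≤n)) =
      solve 2 (λ x y → con (d₄ 1) :* x :* con (+ 0) :+ con (d₈ 1) :* y :* con (+ 0) := con (+ 0)) refl (χ₄ M) (χ₈ M)
    by-α 2 some₄ _
      rewrite ∏[1-]-some-pos χ₄ p (some₄ (s≤s (s≤s z≤n))) =
      solve 1 (λ x → con (d₄ 2) :* x :* con (+ 0) :+ con (+ 0) := con (+ 0)) refl (χ₄ M)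
    by-α (suc (suc (suc _))) _ _ = refl

-- Residues of the primes mod 8

module _ {k} {p : Fin k → ℕ} where

  ResidueSetIs⇒χ : ∀ {S} (χ-table : ℕ → ℤ) → All (λ r → χ-table r ≡ -1ℤ) S → ResidueSetIs k p S
                 → ∀ i → χ-table (p i % 8) ≡ -1ℤ
  ResidueSetIs⇒χ χ-table χ≡-1 (R⊆S , _) i = All.lookup χ≡-1 (R⊆S i)

  residues-5-7⇒χ : ResidueSetIs k p (5 ∷ 7 ∷ []) ⊎ ResidueSetIs k p (5 ∷ [])
                 → (∀ i → χ₈ (p i) ≡ -1ℤ) × (∃ λ i → χ₄ (p i) ≡ + 1)
  residues-5-7⇒χ (inj₁ R) = ResidueSetIs⇒χ χ₈-table (refl All.∷ refl All.∷ All.[]) R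
                          , let (i , pᵢ≡5) = proj₂ R 5 (here refl) in i , cong χ₄-table pᵢ≡5
  residues-5-7⇒χ (inj₂ R) = ResidueSetIs⇒χ χ₈-table (refl All.∷ All.[]) R
                          , let (i , pᵢ≡5) = proj₂ R 5 (here refl) in i , cong χ₄-table pᵢ≡5

  residues-3-7⇒χ : ResidueSetIs k p (3 ∷ 7 ∷ []) ⊎ ResidueSetIs k p (3 ∷ [])
                 → (∀ i → χ₄ (p i) ≡ -1ℤ) × (∃ λ i → χ₈ (p i) ≡ + 1)
  residues-3-7⇒χ (inj₁ R) = ResidueSetIs⇒χ χ₄-table (refl All.∷ refl All.∷ All.[]) R
                          , let (i , pᵢ≡3) = proj₂ R 3 (here refl) in i , cong χ₈-table pᵢ≡3
  residues-3-7⇒χ (inj₂ R) = ResidueSetIs⇒χ χ₄-table (refl All.∷ All.[]) R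
                          , let (i , pᵢ≡3) = proj₂ R 3 (here refl) in i , cong χ₈-table pᵢ≡3

  residues-7⇒χ : ResidueSetIs k p (7 ∷ []) → (∀ i → χ₄ (p i) ≡ -1ℤ) × (∀ i → χ₈ (p i) ≡ -1ℤ)
  residues-7⇒χ R = ResidueSetIs⇒χ χ₄-table (refl All.∷ All.[]) R
                 , ResidueSetIs⇒χ χ₈-table (refl All.∷ All.[]) R

  residues⊆-u-7 : 1 ≤ k → ∀ u → (∀ i → p i % 8 ≡ u ⊎ p i % 8 ≡ 7)
                → ResidueSetIs k p (u ∷ 7 ∷ []) ⊎ ResidueSetIs k p (u ∷ []) ⊎ ResidueSetIs k p (7 ∷ [])
  residues⊆-u-7 1≤k u R⊆ with Finₚ.any? (λ i → p i % 8 ≟ u) | Finₚ.any? (λ i → p i % 8 ≟ 7)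
  ... | yes u∈R | yes 7∈R = inj₁ ( (λ i → either here (there ∘ here) (R⊆ i))
                                 , λ { _ (here refl) → u∈R ; _ (there (here refl)) → 7∈R })
  ... | yes u∈R | no 7∉R = inj₂ (inj₁ ( (λ i → either here (λ pᵢ≡7 → ⊥-elim (7∉R (i , pᵢ≡7))) (R⊆ i))
                                      , λ { _ (here refl) → u∈R }))
  ... | no u∉R | yes 7∈R = inj₂ (inj₂ ( (λ i → either (λ pᵢ≡u → ⊥-elim (u∉R (i , pᵢ≡u))) here (R⊆ i))
                                      , λ { _ (here refl) → 7∈R }))
  ... | no u∉R | no 7∉R = ⊥-elim (either (λ pᵢ≡u → u∉R (i₀ , pᵢ≡u)) (λ pᵢ≡7 → 7∉R (i₀ , pᵢ≡7)) (R⊆ i₀))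
    where i₀ = Fin.fromℕ< 1≤k

  other-residues⇒χ : 1 ≤ k → (∀ i → Odd (p i)) → ∀ α
                   → ¬ ((α ≤ 1) × (ResidueSetIs k p (5 ∷ 7 ∷ []) ⊎ ResidueSetIs k p (5 ∷ [])))
                   → ¬ ((α ≤ 2) × (ResidueSetIs k p (3 ∷ 7 ∷ []) ⊎ ResidueSetIs k p (3 ∷ [])))
                   → ¬ ((α ≤ 2) × ResidueSetIs k p (7 ∷ []))
                   → (α ≤ 2 → ∃ λ i → χ₄ (p i) ≡ + 1) × (α ≤ 1 → ∃ λ i → χ₈ (p i) ≡ + 1)
  other-residues⇒χ 1≤k p-odd α ¬R₅₇ ¬R₃₇ ¬R₇ = some-χ₄-pos , some-χ₈-pos
    where
    some-χ₄-pos : α ≤ 2 → ∃ λ i → χ₄ (p i) ≡ + 1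
    some-χ₄-pos α≤2 with Finₚ.any? (λ i → χ₄ (p i) ℤ.≟ + 1)
    ... | yes found = found
    ... | no none
      with residues⊆-u-7 1≤k 3 (λ i → either (λ χ₄≡1 → ⊥-elim (none (i , χ₄≡1))) id (χ₄-odd (p i) (p-odd i)))
    ...   | inj₁ R = ⊥-elim (¬R₃₇ (α≤2 , inj₁ R))
    ...   | inj₂ (inj₁ R) = ⊥-elim (¬R₃₇ (α≤2 , inj₂ R))
    ...   | inj₂ (inj₂ R) = ⊥-elim (¬R₇ (α≤2 , R))
    some-χ₈-pos : α ≤ 1 → ∃ λ i → χ₈ (p i) ≡ + 1
    some-χ₈-pos α≤1 with Finₚ.any? (λ i → χ₈ (p i) ℤ.≟ + 1)
    ... | yes found = found
    ... | no none
      with residues⊆-u-7 1≤k 5 (λ i → either (λ χ₈≡1 → ⊥-elim (none (i , χ₈≡1))) id (χ₈-odd (p i) (p-odd i)))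
    ...   | inj₁ R = ⊥-elim (¬R₅₇ (α≤1 , inj₁ R))
    ...   | inj₂ (inj₁ R) = ⊥-elim (¬R₅₇ (α≤1 , inj₂ R))
    ...   | inj₂ (inj₂ R) = ⊥-elim (¬R₇ (m≤n⇒m≤1+n α≤1 , R))

toℚ : ℤ → ℚ
toℚ i = i ℚ./ 1

private
  toℚᵘ-toℚ : ∀ i → toℚᵘ (toℚ i) ℚᵘ.≃ ℚᵘ.mkℚᵘ i 0
  toℚᵘ-toℚ i = toℚᵘ-fromℚᵘ (ℚᵘ.mkℚᵘ i 0)

toℚ-+ : ∀ i j → toℚ (i ℤ.+ j) ≡ toℚ i ℚ.+ toℚ j
toℚ-+ i j = toℚᵘ-injective (begin
  toℚᵘ (toℚ (i ℤ.+ j))                   ≈⟨ toℚᵘ-toℚ (i ℤ.+ j) ⟩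
  ℚᵘ.mkℚᵘ (i ℤ.+ j) 0
    ≈⟨ ℚᵘ.*≡* (cong₂ (λ x y → (x ℤ.+ y) ℤ.* + 1) (ℤₚ.*-identityʳ i) (ℤₚ.*-identityʳ j)) ⟨
  ℚᵘ.mkℚᵘ i 0 ℚᵘ.+ ℚᵘ.mkℚᵘ j 0            ≈⟨ ℚᵘₚ.+-cong (toℚᵘ-toℚ i) (toℚᵘ-toℚ j) ⟨
  toℚᵘ (toℚ i) ℚᵘ.+ toℚᵘ (toℚ j)          ≈⟨ toℚᵘ-homo-+ (toℚ i) (toℚ j) ⟨
  toℚᵘ (toℚ i ℚ.+ toℚ j)                 ∎)
  where open ℚᵘₚ.≃-Reasoning

toℚ-* : ∀ i j → toℚ (i ℤ.* j) ≡ toℚ i ℚ.* toℚ j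
toℚ-* i j = toℚᵘ-injective (begin
  toℚᵘ (toℚ (i ℤ.* j))                   ≈⟨ toℚᵘ-toℚ (i ℤ.* j) ⟩
  ℚᵘ.mkℚᵘ (i ℤ.* j) 0                     ≈⟨ ℚᵘ.*≡* refl ⟩
  ℚᵘ.mkℚᵘ i 0 ℚᵘ.* ℚᵘ.mkℚᵘ j 0            ≈⟨ ℚᵘₚ.*-cong (toℚᵘ-toℚ i) (toℚᵘ-toℚ j) ⟨
  toℚᵘ (toℚ i) ℚᵘ.* toℚᵘ (toℚ j)          ≈⟨ toℚᵘ-homo-* (toℚ i) (toℚ j) ⟨
  toℚᵘ (toℚ i ℚ.* toℚ j)                 ∎)
  where open ℚᵘₚ.≃-Reasoning

toℚ-neg : ∀ i → toℚ (ℤ.- i) ≡ ℚ.- toℚ i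
toℚ-neg i = toℚᵘ-injective (begin
  toℚᵘ (toℚ (ℤ.- i))                     ≈⟨ toℚᵘ-toℚ (ℤ.- i) ⟩
  ℚᵘ.mkℚᵘ (ℤ.- i) 0                       ≈⟨ ℚᵘₚ.-‿cong (toℚᵘ-toℚ i) ⟨
  ℚᵘ.- toℚᵘ (toℚ i)                       ≈⟨ toℚᵘ-homo‿- (toℚ i) ⟨
  toℚᵘ (ℚ.- toℚ i)                       ∎)
  where open ℚᵘₚ.≃-Reasoning

toℚ-^ : ∀ i m → toℚ (i ℤ.^ m) ≡ toℚ i ^ℚ m
toℚ-^ i zero = refl
toℚ-^ i (suc m) = trans (toℚ-* i (i ℤ.^ m)) (cong (toℚ i ℚ.*_) (toℚ-^ i m))

toℚ-monomial : ∀ c o w → toℚ (c ℤ.* -1ℤ ℤ.^ o ℤ.* (+ 2) ℤ.^ w) ≡ toℚ c ℚ.* (-1ℚ ^ℚ o) ℚ.* (ℕ→ℚ 2 ^ℚ w)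
toℚ-monomial c o w = begin
  toℚ (c ℤ.* -1ℤ ℤ.^ o ℤ.* (+ 2) ℤ.^ w)               ≡⟨ toℚ-* (c ℤ.* -1ℤ ℤ.^ o) _ ⟩
  toℚ (c ℤ.* -1ℤ ℤ.^ o) ℚ.* toℚ ((+ 2) ℤ.^ w)         ≡⟨ cong₂ ℚ._*_ (toℚ-* c _) (toℚ-^ (+ 2) w) ⟩
  toℚ c ℚ.* toℚ (-1ℤ ℤ.^ o) ℚ.* (ℕ→ℚ 2 ^ℚ w)          ≡⟨ cong (λ σ → toℚ c ℚ.* σ ℚ.* (ℕ→ℚ 2 ^ℚ w)) (toℚ-^ -1ℤ o) ⟩
  toℚ c ℚ.* (-1ℚ ^ℚ o) ℚ.* (ℕ→ℚ 2 ^ℚ w)               ∎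
  where open ≡-Reasoning

solve-y-8x : ∀ {x y : ℕ} {D : ℤ} (T : ℚ) → + y ℤ.- + 8 ℤ.* + x ≡ D → (+ 1 ℚ./ 8) ℚ.* toℚ D ≡ ℚ.- T
           → ℕ→ℚ x ≡ (+ 1 ℚ./ 8) ℚ.* ℕ→ℚ y ℚ.+ T
solve-y-8x {x} {y} {D} T y-8x≡D D/8≡-T = begin
  ℕ→ℚ x
    ≡⟨ solve 2 (λ x y → x := con ⅛ :* y :- con ⅛ :* (y :- con (ℕ→ℚ 8) :* x)) refl (ℕ→ℚ x) (ℕ→ℚ y) ⟩
  ⅛ ℚ.* ℕ→ℚ y ℚ.- ⅛ ℚ.* (ℕ→ℚ y ℚ.- ℕ→ℚ 8 ℚ.* ℕ→ℚ x)
    ≡⟨ cong (λ d → ⅛ ℚ.* ℕ→ℚ y ℚ.- ⅛ ℚ.* d) (trans y-8x≡toℚ (cong toℚ y-8x≡D)) ⟩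
  ⅛ ℚ.* ℕ→ℚ y ℚ.- ⅛ ℚ.* toℚ D
    ≡⟨ cong (λ d → ⅛ ℚ.* ℕ→ℚ y ℚ.- d) D/8≡-T ⟩
  ⅛ ℚ.* ℕ→ℚ y ℚ.- ℚ.- T
    ≡⟨ solve 2 (λ y t → con ⅛ :* y :- (:- t) := con ⅛ :* y :+ t) refl (ℕ→ℚ y) T ⟩
  ⅛ ℚ.* ℕ→ℚ y ℚ.+ T ∎
  where
  open ≡-Reasoning
  open ℚ-Solver.+-*-Solver
  ⅛ = + 1 ℚ./ 8
  y-8x≡toℚ : ℕ→ℚ y ℚ.- ℕ→ℚ 8 ℚ.* ℕ→ℚ x ≡ toℚ (+ y ℤ.- + 8 ℤ.* + x)
  y-8x≡toℚ = sym (begin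
    toℚ (+ y ℤ.- + 8 ℤ.* + x)               ≡⟨ toℚ-+ (+ y) (ℤ.- (+ 8 ℤ.* + x)) ⟩
    ℕ→ℚ y ℚ.+ toℚ (ℤ.- (+ 8 ℤ.* + x))       ≡⟨ cong (ℕ→ℚ y ℚ.+_) (toℚ-neg (+ 8 ℤ.* + x)) ⟩
    ℕ→ℚ y ℚ.- toℚ (+ 8 ℤ.* + x)             ≡⟨ cong (λ z → ℕ→ℚ y ℚ.- z) (toℚ-* (+ 8) (+ x)) ⟩
    ℕ→ℚ y ℚ.- ℕ→ℚ 8 ℚ.* ℕ→ℚ x               ∎)

solve-y-8x₁ : ∀ {x y} o w → + y ℤ.- + 8 ℤ.* + x ≡ -[1+ 1 ] ℤ.* -1ℤ ℤ.^ o ℤ.* (+ 2) ℤ.^ w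
            → ℕ→ℚ x ≡ (+ 1 ℚ./ 8) ℚ.* ℕ→ℚ y ℚ.+ (+ 1 ℚ./ 4) ℚ.* (-1ℚ ^ℚ o) ℚ.* (ℕ→ℚ 2 ^ℚ w)
solve-y-8x₁ {x} {y} o w eq = solve-y-8x {x} {y} _ eq (begin
  (+ 1 ℚ./ 8) ℚ.* toℚ (-[1+ 1 ] ℤ.* -1ℤ ℤ.^ o ℤ.* (+ 2) ℤ.^ w)
    ≡⟨ cong ((+ 1 ℚ./ 8) ℚ.*_) (toℚ-monomial -[1+ 1 ] o w) ⟩
  (+ 1 ℚ./ 8) ℚ.* (toℚ -[1+ 1 ] ℚ.* σ ℚ.* τ)
    ≡⟨ solve 2 (λ σ τ → con (+ 1 ℚ./ 8) :* (con (toℚ -[1+ 1 ]) :* σ :* τ) := :- (con (+ 1 ℚ./ 4) :* σ :* τ))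
             refl σ τ ⟩
  ℚ.- ((+ 1 ℚ./ 4) ℚ.* σ ℚ.* τ) ∎)
  where
  open ≡-Reasoning
  open ℚ-Solver.+-*-Solver
  σ = -1ℚ ^ℚ o
  τ = ℕ→ℚ 2 ^ℚ w

solve-y-8x₂ : ∀ {x y} o w → + y ℤ.- + 8 ℤ.* + x ≡ -1ℤ ℤ.* -1ℤ ℤ.^ o ℤ.* (+ 2) ℤ.^ w
            → ℕ→ℚ x ≡ (+ 1 ℚ./ 8) ℚ.* ℕ→ℚ y ℚ.+ (+ 1 ℚ./ 8) ℚ.* (-1ℚ ^ℚ o) ℚ.* (ℕ→ℚ 2 ^ℚ w)
solve-y-8x₂ {x} {y} o w eq = solve-y-8x {x} {y} _ eq (begin
  (+ 1 ℚ./ 8) ℚ.* toℚ (-1ℤ ℤ.* -1ℤ ℤ.^ o ℤ.* (+ 2) ℤ.^ w)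
    ≡⟨ cong ((+ 1 ℚ./ 8) ℚ.*_) (toℚ-monomial -1ℤ o w) ⟩
  (+ 1 ℚ./ 8) ℚ.* (toℚ -1ℤ ℚ.* σ ℚ.* τ)
    ≡⟨ solve 2 (λ σ τ → con (+ 1 ℚ./ 8) :* (con (toℚ -1ℤ) :* σ :* τ) := :- (con (+ 1 ℚ./ 8) :* σ :* τ))
             refl σ τ ⟩
  ℚ.- ((+ 1 ℚ./ 8) ℚ.* σ ℚ.* τ) ∎)
  where
  open ≡-Reasoning
  open ℚ-Solver.+-*-Solver
  σ = -1ℚ ^ℚ o
  τ = ℕ→ℚ 2 ^ℚ w

solve-y-8x₃ : ∀ {x y} o w c o′ w′
            → + y ℤ.- + 8 ℤ.* + x ≡ -1ℤ ℤ.* -1ℤ ℤ.^ o ℤ.* (+ 2) ℤ.^ w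
                                    ℤ.+ -[1+ 1 ] ℤ.* (+ 1 ℤ.- + c) ℤ.* -1ℤ ℤ.^ o′ ℤ.* (+ 2) ℤ.^ w′
            → ℕ→ℚ x ≡ (+ 1 ℚ./ 8) ℚ.* ℕ→ℚ y ℚ.+ (+ 1 ℚ./ 8) ℚ.* (-1ℚ ^ℚ o) ℚ.* (ℕ→ℚ 2 ^ℚ w)
                      ℚ.+ ((1ℚ ℚ.- ℕ→ℚ c) ℚ.* (+ 1 ℚ./ 4)) ℚ.* (-1ℚ ^ℚ o′) ℚ.* (ℕ→ℚ 2 ^ℚ w′)
solve-y-8x₃ {x} {y} o w c o′ w′ eq = trans (solve-y-8x {x} {y} _ eq (begin
  (+ 1 ℚ./ 8) ℚ.* toℚ (-1ℤ ℤ.* -1ℤ ℤ.^ o ℤ.* (+ 2) ℤ.^ w ℤ.+ γ ℤ.* -1ℤ ℤ.^ o′ ℤ.* (+ 2) ℤ.^ w′)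
    ≡⟨ cong ((+ 1 ℚ./ 8) ℚ.*_) (trans (toℚ-+ (-1ℤ ℤ.* -1ℤ ℤ.^ o ℤ.* (+ 2) ℤ.^ w) _)
                                      (cong₂ ℚ._+_ (toℚ-monomial -1ℤ o w) (toℚ-monomial γ o′ w′))) ⟩
  (+ 1 ℚ./ 8) ℚ.* (toℚ -1ℤ ℚ.* σ ℚ.* τ ℚ.+ toℚ γ ℚ.* σ′ ℚ.* τ′)
    ≡⟨ cong (λ e → (+ 1 ℚ./ 8) ℚ.* (toℚ -1ℤ ℚ.* σ ℚ.* τ ℚ.+ e ℚ.* σ′ ℚ.* τ′)) toℚ-γ ⟩
  (+ 1 ℚ./ 8) ℚ.* (toℚ -1ℤ ℚ.* σ ℚ.* τ ℚ.+ toℚ -[1+ 1 ] ℚ.* (1ℚ ℚ.- ℕ→ℚ c) ℚ.* σ′ ℚ.* τ′)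
    ≡⟨ solve 5 (λ σ τ d σ′ τ′ → con (+ 1 ℚ./ 8) :* (con (toℚ -1ℤ) :* σ :* τ :+ con (toℚ -[1+ 1 ]) :* d :* σ′ :* τ′)
                             := :- (con (+ 1 ℚ./ 8) :* σ :* τ :+ (d :* con (+ 1 ℚ./ 4)) :* σ′ :* τ′))
             refl σ τ (1ℚ ℚ.- ℕ→ℚ c) σ′ τ′ ⟩
  ℚ.- ((+ 1 ℚ./ 8) ℚ.* σ ℚ.* τ ℚ.+ ((1ℚ ℚ.- ℕ→ℚ c) ℚ.* (+ 1 ℚ./ 4)) ℚ.* σ′ ℚ.* τ′) ∎))
  (sym (ℚₚ.+-assoc ((+ 1 ℚ./ 8) ℚ.* ℕ→ℚ y) _ _))
  where
  open ≡-Reasoning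
  open ℚ-Solver.+-*-Solver
  γ = -[1+ 1 ] ℤ.* (+ 1 ℤ.- + c)
  σ = -1ℚ ^ℚ o
  τ = ℕ→ℚ 2 ^ℚ w
  σ′ = -1ℚ ^ℚ o′
  τ′ = ℕ→ℚ 2 ^ℚ w′
  toℚ-γ : toℚ γ ≡ toℚ -[1+ 1 ] ℚ.* (1ℚ ℚ.- ℕ→ℚ c)
  toℚ-γ = begin
    toℚ γ                                          ≡⟨ toℚ-* -[1+ 1 ] (+ 1 ℤ.- + c) ⟩
    toℚ -[1+ 1 ] ℚ.* toℚ (+ 1 ℤ.- + c)             ≡⟨ cong (toℚ -[1+ 1 ] ℚ.*_) (toℚ-+ (+ 1) (ℤ.- + c)) ⟩
    toℚ -[1+ 1 ] ℚ.* (1ℚ ℚ.+ toℚ (ℤ.- + c))        ≡⟨ cong (λ z → toℚ -[1+ 1 ] ℚ.* (1ℚ ℚ.+ z)) (toℚ-neg (+ c)) ⟩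
    toℚ -[1+ 1 ] ℚ.* (1ℚ ℚ.- ℕ→ℚ c)               ∎

solve-y-8x≡0 : ∀ {x y} → + y ℤ.- + 8 ℤ.* + x ≡ + 0 → ℕ→ℚ x ≡ (+ 1 ℚ./ 8) ℚ.* ℕ→ℚ y
solve-y-8x≡0 {x} {y} eq = trans (solve-y-8x {x} {y} ℚ.0ℚ eq refl) (ℚₚ.+-identityʳ _)

theorem3p1 : (α k : ℕ) → 1 ≤ k
  → (p : Fin k → ℕ) → (∀ i → Prime (p i)) → (∀ i → p i % 2 ≡ 1) → Injective _≡_ _≡_ p
  → (a : Fin k → ℕ) → (∀ i → 1 ≤ a i)
  → (n : ℕ) → n ≡ 2 ^ α * ∏ k (λ i → p i ^ a i) → 8 < n
  → let C₁ = (α ≤ 1) × (ResidueSetIs k p (5 ∷ 7 ∷ []) ⊎ ResidueSetIs k p (5 ∷ []))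
        C₂ = (α ≤ 2) × (ResidueSetIs k p (3 ∷ 7 ∷ []) ⊎ ResidueSetIs k p (3 ∷ []))
        C₃ = (α ≤ 2) × ResidueSetIs k p (7 ∷ [])
        main = (+ 1 ℚ./ 8) ℚ.* ℕ→ℚ (φ n)
    in (C₁ → ℕ→ℚ (φ[ 8 ] n)
              ≡ main ℚ.+ (+ 1 ℚ./ 4) ℚ.* (-1ℚ ^ℚ Ω n) ℚ.* (ℕ→ℚ 2 ^ℚ (ω n ∸ α)))
     × (C₂ → ℕ→ℚ (φ[ 8 ] n)
              ≡ main ℚ.+ (+ 1 ℚ./ 8) ℚ.* (-1ℚ ^ℚ (Ω n ∸ ((α + 1) / 2)))
                         ℚ.* (ℕ→ℚ 2 ^ℚ (ω n ∸ (α % 2))))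
     × (C₃ → ℕ→ℚ (φ[ 8 ] n)
              ≡ main ℚ.+ (+ 1 ℚ./ 8) ℚ.* (-1ℚ ^ℚ (Ω n ∸ (α / 2)))
                         ℚ.* (ℕ→ℚ 2 ^ℚ (ω n ∸ (α % 2)))
                     ℚ.+ ((1ℚ ℚ.- ℕ→ℚ ((α + 1) / 2)) ℚ.* (+ 1 ℚ./ 4))
                         ℚ.* (-1ℚ ^ℚ Ω n) ℚ.* (ℕ→ℚ 2 ^ℚ ω n))
     × (¬ C₁ → ¬ C₂ → ¬ C₃ → ℕ→ℚ (φ[ 8 ] n) ≡ main)
theorem3p1 α k 1≤k p p-prime p-odd p-inj a a-pos n refl _ =
  (λ (α≤1 , R) → let (χ₈-neg , χ₄-pos) = residues-5-7⇒χ {p = p} R in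
     solve-y-8x₁ {φ[ 8 ] n} {φ n} (Ω n) (ω n ∸ α) (φ-8φ₈-χ₈-neg fam p-odd 1≤k α α≤1 χ₈-neg χ₄-pos)) ,
  (λ (α≤2 , R) → let (χ₄-neg , χ₈-pos) = residues-3-7⇒χ {p = p} R in
     solve-y-8x₂ {φ[ 8 ] n} {φ n} (Ω n ∸ ((α + 1) / 2)) (ω n ∸ (α % 2))
               (φ-8φ₈-χ₄-neg fam p-odd 1≤k α α≤2 χ₄-neg χ₈-pos)) ,
  (λ (α≤2 , R) → let (χ₄-neg , χ₈-neg) = residues-7⇒χ {p = p} R in
     solve-y-8x₃ {φ[ 8 ] n} {φ n} (Ω n ∸ (α / 2)) (ω n ∸ (α % 2)) ((α + 1) / 2) (Ω n) (ω n)
               (φ-8φ₈-χ₄χ₈-neg fam p-odd 1≤k α α≤2 χ₄-neg χ₈-neg)) ,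
  (λ ¬R₅₇ ¬R₃₇ ¬R₇ → let (χ₄-pos , χ₈-pos) = other-residues⇒χ {p = p} 1≤k p-odd α ¬R₅₇ ¬R₃₇ ¬R₇ in
     solve-y-8x≡0 {φ[ 8 ] n} {φ n} (φ-8φ₈-otherwise fam p-odd 1≤k α χ₄-pos χ₈-pos))
  where
  fam : DistinctPrimePowers p a
  fam = record { prime = p-prime ; injective = p-inj ; exponent-pos = a-pos }
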